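{- Let $\vec G$ be any orientation of the Coxeter diagram of $S_n$. Then the Cambrian lattice $\mathcal C(\vec G)$ is a sublattice of the weak order on $S_n$; precisely, the set of minimal elements of the congruence classes of $\Theta(\vec G)$ (which, with the induced order, is isomorphic to $\mathcal C(\vec G)$) is closed under the meet and join of the weak order on $S_n$.
   Context: $S_n$ has simple reflections $s_i=(i,i+1)$, $i\in[n-1]$; its Coxeter diagram is the path $s_1-\cdots-s_{n-1}$ (edges labeled $3$); an orientation directs each edge. Weak order: $x\le y$ iff $I(x)\subseteq I(y)$, $I(x)=\{(x_j,x_i):i<j,\ x_i>x_j\}$ in one-line notation; it is a lattice. The Cambrian congruence $\Theta(\vec G)$ is the smallest lattice congruence of the weak order with $t\equiv ts$ for each directed edge $s\to t$ of $\vec G$; $\mathcal C(\vec G)$ is the quotient lattice. Each congruence class of a lattice congruence of a finite lattice is an interval, and the quotient is isomorphic to the induced subposet of minimal elements of the classes. -}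

module Defs where

open import Level using (Level; suc; zero)
open import Data.Nat as ℕ using (ℕ; _+_)
open import Data.Bool using (Bool; true; false)
open import Data.Fin using (Fin; fromℕ<; _<_)
open import Data.Fin.Permutation using (Permutation′; _⟨$⟩ʳ_; _∘ₚ_; transpose)
open import Data.Product using (Σ; ∃; _×_; _,_)
open import Relation.Binary.PropositionalEquality using (_≡_)

-- Elements of S_n, in one-line notation: x i = x ⟨$⟩ʳ i  (positions/values 0-based).
Perm : ℕ → Set
Perm n = Permutation′ n

-- Product of permutations as functions: (x · y)(k) = x (y k).
_·_ : ∀ {n} → Perm n → Perm n → Perm n
x · y = y ∘ₚ x

-- Simple reflection s_i = (i, i+1) (0-based: i ranges over 0 … n-2).
sref : ∀ {n} (i : ℕ) → ℕ.suc i ℕ.< n → Perm n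
sref {n} i p = transpose (fromℕ< (ℕ.≤-trans (ℕ.n≤1+n (ℕ.suc i)) p)) (fromℕ< p)
  where import Data.Nat.Properties as ℕ

-- Inversion set I(x) = {(x_j, x_i) : i < j, x_i > x_j}:
-- Inv x a b  means  (a , b) ∈ I(x).
Inv : ∀ {n} → Perm n → Fin n → Fin n → Set
Inv x a b = Σ _ λ i → Σ _ λ j → (i < j) × (x ⟨$⟩ʳ j ≡ a) × (x ⟨$⟩ʳ i ≡ b) × (a < b)

_≤w_ : ∀ {n} → Perm n → Perm n → Set
x ≤w y = ∀ a b → Inv x a b → Inv y a b

IsMeet : ∀ {n} → Perm n → Perm n → Perm n → Set
IsMeet x y m = (m ≤w x) × (m ≤w y) × (∀ z → z ≤w x → z ≤w y → z ≤w m)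

IsJoin : ∀ {n} → Perm n → Perm n → Perm n → Set
IsJoin x y j = (x ≤w j) × (y ≤w j) × (∀ z → x ≤w z → y ≤w z → j ≤w z)

Rel : ℕ → Set₁
Rel n = Perm n → Perm n → Set

record IsLatticeCongruence {n} (R : Rel n) : Set where
  field
    refl  : ∀ x → R x x
    sym   : ∀ x y → R x y → R y x
    trans : ∀ x y z → R x y → R y z → R x z
    meet-compat : ∀ x x′ y y′ m m′ → R x x′ → R y y′ →
                  IsMeet x y m → IsMeet x′ y′ m′ → R m m′
    join-compat : ∀ x x′ y y′ j j′ → R x x′ → R y y′ →
                  IsJoin x y j → IsJoin x′ y′ j′ → R j j′

-- An orientation of the Coxeter diagram s_0 - s_1 - … - s_{n-2} of S_n:
-- for each edge {s_i, s_{i+1}} (i + 2 < n), true means s_i → s_{i+1},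
-- false means s_{i+1} → s_i.
Orientation : ℕ → Set
Orientation n = (i : ℕ) → ℕ.suc (ℕ.suc i) ℕ.< n → Bool

-- R contains t ≡ ts for every directed edge s → t.
Generates : ∀ {n} → Orientation n → Rel n → Set
Generates {n} o R = ∀ i (p : ℕ.suc (ℕ.suc i) ℕ.< n) → edge (o i p) i p
  where
    import Data.Nat.Properties as ℕ
    edge : Bool → (i : ℕ) → ℕ.suc (ℕ.suc i) ℕ.< n → Set
    edge true  i p = R (sref (ℕ.suc i) p) (sref (ℕ.suc i) p · sref i (ℕ.<-trans (ℕ.n<1+n _) p))
    edge false i p = R (sref i (ℕ.<-trans (ℕ.n<1+n _) p)) (sref i (ℕ.<-trans (ℕ.n<1+n _) p) · sref (ℕ.suc i) p)

-- The Cambrian congruence Θ(G): the smallest lattice congruence containing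
-- the generating pairs (intersection of all such congruences).
Θ : ∀ {n} → Orientation n → Perm n → Perm n → Set₁
Θ {n} o x y = (R : Rel n) → IsLatticeCongruence R → Generates o R → R x y

IsCambrianMin : ∀ {n} → Orientation n → Perm n → Set₁
IsCambrianMin o x = ∀ y → Θ o y x → y ≤w x → x ≤w y

-- The orientation puts every inner point on a side, left or right, and the join-irreducibles of
-- the weak order are Reading's arcs (a, c) with a side for each inner point. A lattice congruence
-- containing the generators contracts every arc with an inner point on the wrong side: the
-- generators are the wrong arcs of length 2, and a forcing square (join, meet, join) carries the
-- contraction of an arc to the arc one point longer. So the bottom x of a Θ-class has no adjacent
-- descent jumping over a point on the wrong side, i.e. x avoids the two barred patterns, and then
-- every inversion of x is a chain of Cambrian arcs below x. Conversely, "having the same Cambrian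
-- arcs below" is a lattice congruence containing the generators (for joins: a Cambrian arc below
-- x ∨ y splits into Cambrian arcs below x or below y), so it contains Θ. Hence a meet m of bottoms,
-- which avoids the patterns again since the non-inversions of x ∧ y are chains of non-inversions of
-- x or y, lies below every z ≡ m; and a join j of bottoms x, y lies below every z ≡ j, because the
-- Cambrian arcs generating x and y lie below j, hence below z.

module Submission where

open import Defs
open import Data.Bool using (Bool; true; false; if_then_else_; T)
import Data.Bool as Bool
open import Data.Bool.Properties using (T-≡; ¬-not)
open import Data.Empty using (⊥; ⊥-elim)
open import Data.Fin as Fin using (Fin; toℕ; fromℕ<; _<_; _<?_)
import Data.Fin.Properties as Finₚ
open import Data.Fin.Permutation using (permutation; _⟨$⟩ʳ_; _⟨$⟩ˡ_; inverseˡ; inverseʳ)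
import Data.Fin.Permutation as Permutation
import Data.Fin.Permutation.Components as PC
open import Data.Fin.Subset using (Subset; ∣_∣; _∈_)
open import Data.Fin.Subset.Properties using (p⊂q⇒∣p∣<∣q∣; ∣⊤∣≡n; ∈⊤)
open import Data.List using (List; []; _∷_; length)
open import Data.Nat as ℕ using (ℕ; zero; suc; _+_; _*_; _∸_)
import Data.Nat.Properties as ℕₚ
open import Data.Product using (∃; _×_; _,_; proj₁; proj₂)
import Data.Product as Product
open import Data.Sum using (_⊎_; inj₁; inj₂)
import Data.Sum as Sum
open import Data.Unit using (tt)
open import Data.Vec using (tabulate)
open import Data.Vec.Properties using (lookup∘tabulate; []=⇒lookup; lookup⇒[]=)
open import Function using (_∘_; flip; id; _⇔_; mk⇔; Equivalence)
open import Relation.Binary.Construct.Closure.Transitive using (TransClosure; [_]; _∷_; _++_; transitive⁻)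
open import Relation.Binary.Definitions using (Tri; tri<; tri≈; tri>)
open import Relation.Binary.PropositionalEquality using (_≡_; _≢_; refl; sym; trans; cong; subst; subst₂)
open import Relation.Nullary using (¬_; ¬?; Dec; yes; no; does; _×-dec_)
open import Relation.Nullary.Decidable using (dec-true; dec-false; toWitness; toWitnessFalse; True; False; _⊎-dec_; _→-dec_; T?; decidable-stable)
import Relation.Nullary.Decidable as Dec
import Relation.Unary as U

module _ {n : ℕ} where

  pos : Perm n → Fin n → Fin n
  pos x v = x ⟨$⟩ˡ v

  Before : Perm n → Fin n → Fin n → Set
  Before x u v = pos x u < pos x v

  record Inversion (x : Perm n) (a b : Fin n) : Set where
    constructor inversion
    field
      ordered : a < b
      flipped : Before x b a

  record NonInversion (x : Perm n) (a b : Fin n) : Set where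
    constructor noninversion
    field
      ordered : a < b
      kept    : Before x a b

  infix 4 _⊑_

  _⊑_ : Perm n → Perm n → Set
  x ⊑ y = ∀ {a b} → Inversion x a b → Inversion y a b

  pos-injective : ∀ x {u v} → pos x u ≡ pos x v → u ≡ v
  pos-injective x {u} {v} e = trans (sym (inverseʳ x)) (trans (cong (x ⟨$⟩ʳ_) e) (inverseʳ x))

  pos-⟨$⟩ʳ : ∀ x {i v} → x ⟨$⟩ʳ i ≡ v → pos x v ≡ i
  pos-⟨$⟩ʳ x e = trans (cong (x ⟨$⟩ˡ_) (sym e)) (inverseˡ x)

  Before-total : ∀ x {u v} → u ≢ v → Before x u v ⊎ Before x v u
  Before-total x {u} {v} u≢v with Finₚ.<-cmp (pos x u) (pos x v)
  ... | tri< p _ _ = inj₁ p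
  ... | tri≈ _ e _ = ⊥-elim (u≢v (pos-injective x e))
  ... | tri> _ _ p = inj₂ p

  Before? : ∀ x u v → Dec (Before x u v)
  Before? x u v = pos x u <? pos x v

  Inversion? : ∀ x a b → Dec (Inversion x a b)
  Inversion? x a b with a <? b ×-dec Before? x b a
  ... | yes (p , q) = yes (inversion p q)
  ... | no ¬pq = no (λ { (inversion p q) → ¬pq (p , q) })

  NonInversion? : ∀ x a b → Dec (NonInversion x a b)
  NonInversion? x a b with a <? b ×-dec Before? x a b
  ... | yes (p , q) = yes (noninversion p q)
  ... | no ¬pq = no (λ { (noninversion p q) → ¬pq (p , q) })

  ¬Inversion⇒Before : ∀ x {a b} → a < b → ¬ Inversion x a b → Before x a b
  ¬Inversion⇒Before x a<b ¬inv with Before-total x (Finₚ.<⇒≢ a<b)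
  ... | inj₁ p = p
  ... | inj₂ p = ⊥-elim (¬inv (inversion a<b p))

  ¬NonInversion⇒Inversion : ∀ x {a b} → a < b → ¬ NonInversion x a b → Inversion x a b
  ¬NonInversion⇒Inversion x a<b ¬non with Before-total x (Finₚ.<⇒≢ a<b)
  ... | inj₁ p = ⊥-elim (¬non (noninversion a<b p))
  ... | inj₂ p = inversion a<b p

  Inversion-trans : ∀ x {a b c} → Inversion x a b → Inversion x b c → Inversion x a c
  Inversion-trans x (inversion a<b ba) (inversion b<c cb) = inversion (Finₚ.<-trans a<b b<c) (Finₚ.<-trans cb ba)

  Inversion-cotrans : ∀ x {a b c} → a < b → b < c → Inversion x a c → Inversion x a b ⊎ Inversion x b c
  Inversion-cotrans x a<b b<c (inversion _ ca) with Before-total x (Finₚ.<⇒≢ a<b)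
  ... | inj₁ ab = inj₂ (inversion b<c (Finₚ.<-trans ca ab))
  ... | inj₂ ba = inj₁ (inversion a<b ba)

  NonInversion-trans : ∀ x {a b c} → NonInversion x a b → NonInversion x b c → NonInversion x a c
  NonInversion-trans x (noninversion a<b ab) (noninversion b<c bc) = noninversion (Finₚ.<-trans a<b b<c) (Finₚ.<-trans ab bc)

  NonInversion-cotrans : ∀ x {a b c} → a < b → b < c → NonInversion x a c → NonInversion x a b ⊎ NonInversion x b c
  NonInversion-cotrans x a<b b<c (noninversion _ ac) with Before-total x (Finₚ.<⇒≢ a<b)
  ... | inj₁ ab = inj₁ (noninversion a<b ab)
  ... | inj₂ ba = inj₂ (noninversion b<c (Finₚ.<-trans ba ac))

  ⊑-refl : ∀ {x} → x ⊑ x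
  ⊑-refl i = i

  ⊑-trans : ∀ {x y z} → x ⊑ y → y ⊑ z → x ⊑ z
  ⊑-trans x⊑y y⊑z = y⊑z ∘ x⊑y

  ⊑⇒NonInversion : ∀ {x y a b} → x ⊑ y → NonInversion y a b → NonInversion x a b
  ⊑⇒NonInversion {x} x⊑y (noninversion a<b ab) with Before-total x (Finₚ.<⇒≢ a<b)
  ... | inj₁ ab′ = noninversion a<b ab′
  ... | inj₂ ba = ⊥-elim (Finₚ.<-asym ab (Inversion.flipped (x⊑y (inversion a<b ba))))

  Inv⇒Inversion : ∀ x {a b} → Inv x a b → Inversion x a b
  Inv⇒Inversion x (i , j , i<j , xj≡a , xi≡b , a<b) =
    inversion a<b (subst₂ _<_ (sym (pos-⟨$⟩ʳ x xi≡b)) (sym (pos-⟨$⟩ʳ x xj≡a)) i<j)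

  Inversion⇒Inv : ∀ x {a b} → Inversion x a b → Inv x a b
  Inversion⇒Inv x {a} {b} (inversion a<b ba) = pos x b , pos x a , ba , inverseʳ x , inverseʳ x , a<b

  ≤w⇒⊑ : ∀ {x y} → x ≤w y → x ⊑ y
  ≤w⇒⊑ {x} {y} x≤y {a} {b} = Inv⇒Inversion y ∘ x≤y a b ∘ Inversion⇒Inv x

  ⊑⇒≤w : ∀ {x y} → x ⊑ y → x ≤w y
  ⊑⇒≤w {x} {y} x⊑y a b = Inversion⇒Inv y ∘ x⊑y ∘ Inv⇒Inversion x

module _ {n : ℕ} {x y : Perm n} where

  isMeet : ∀ {m} → m ⊑ x → m ⊑ y → (∀ z → z ⊑ x → z ⊑ y → z ⊑ m) → IsMeet x y m
  isMeet m⊑x m⊑y greatest =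
    ⊑⇒≤w m⊑x , ⊑⇒≤w m⊑y , λ z z≤x z≤y → ⊑⇒≤w (greatest z (≤w⇒⊑ z≤x) (≤w⇒⊑ z≤y))

  isJoin : ∀ {j} → x ⊑ j → y ⊑ j → (∀ z → x ⊑ z → y ⊑ z → j ⊑ z) → IsJoin x y j
  isJoin x⊑j y⊑j least =
    ⊑⇒≤w x⊑j , ⊑⇒≤w y⊑j , λ z x≤z y≤z → ⊑⇒≤w (least z (≤w⇒⊑ x≤z) (≤w⇒⊑ y≤z))

  meet-of-⊑ : y ⊑ x → IsMeet x y y
  meet-of-⊑ y⊑x = isMeet y⊑x ⊑-refl (λ _ _ z⊑y → z⊑y)

  join-of-⊑ : x ⊑ y → IsJoin x y y
  join-of-⊑ x⊑y = isJoin x⊑y ⊑-refl (λ _ _ y⊑z → y⊑z)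

  join-of-⊒ : y ⊑ x → IsJoin x y x
  join-of-⊒ y⊑x = isJoin ⊑-refl y⊑x (λ _ x⊑z _ → x⊑z)

module MeetOf {n : ℕ} {x y m : Perm n} (M : IsMeet x y m) where

  lowerˡ : m ⊑ x
  lowerˡ = ≤w⇒⊑ (proj₁ M)

  lowerʳ : m ⊑ y
  lowerʳ = ≤w⇒⊑ (proj₁ (proj₂ M))

  greatest : ∀ {z} → z ⊑ x → z ⊑ y → z ⊑ m
  greatest {z} z⊑x z⊑y = ≤w⇒⊑ (proj₂ (proj₂ M) z (⊑⇒≤w z⊑x) (⊑⇒≤w z⊑y))

module JoinOf {n : ℕ} {x y j : Perm n} (J : IsJoin x y j) where

  upperˡ : x ⊑ j
  upperˡ = ≤w⇒⊑ (proj₁ J)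

  upperʳ : y ⊑ j
  upperʳ = ≤w⇒⊑ (proj₁ (proj₂ J))

  least : ∀ {z} → x ⊑ z → y ⊑ z → j ⊑ z
  least {z} x⊑z y⊑z = ≤w⇒⊑ (proj₂ (proj₂ J) z (⊑⇒≤w x⊑z) (⊑⇒≤w y⊑z))

module LatticeCongruence {n : ℕ} {R : Rel n} (R-cong : IsLatticeCongruence R) where

  open IsLatticeCongruence R-cong public
    renaming (refl to R-refl; sym to R-sym; trans to R-trans)

  ⊑-antisym⇒R : ∀ {x y} → x ⊑ y → y ⊑ x → R x y
  ⊑-antisym⇒R {x} {y} x⊑y y⊑x =
    meet-compat x x x x x y (R-refl x) (R-refl x) (meet-of-⊑ {x = x} ⊑-refl) (isMeet y⊑x y⊑x (λ _ z⊑x _ → ⊑-trans z⊑x x⊑y))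

  join-resp : ∀ {p q w j₀ j₁} → R p q → IsJoin p w j₀ → IsJoin q w j₁ → R j₀ j₁
  join-resp {p} {q} {w} {j₀} {j₁} r = join-compat p q w w j₀ j₁ r (R-refl w)

  meet-resp : ∀ {p q w m₀ m₁} → R p q → IsMeet p w m₀ → IsMeet q w m₁ → R m₀ m₁
  meet-resp {p} {q} {w} {m₀} {m₁} r = meet-compat p q w w m₀ m₁ r (R-refl w)

  -- R J₋ J forces R J′₋ J′: join both sides with W, meet with J′, join with J′₋.
  forcing-square : ∀ {J₋ J W T₀ T₁ J′₋ J′ M} → R J₋ J →
                   IsJoin J₋ W T₀ → IsJoin J W T₁ → IsMeet T₀ J′ M → J′ ⊑ T₁ →
                   M ⊑ J′₋ → J′₋ ⊑ J′ → R J′₋ J′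
  forcing-square {W = W} {T₀} {T₁} {J′₋} {J′} {M} r join₀ join₁ meet₀ J′⊑T₁ M⊑J′₋ J′₋⊑J′ = J′₋≡J′
    where
    T₀≡T₁ : R T₀ T₁
    T₀≡T₁ = join-resp {w = W} r join₀ join₁
    M≡J′ : R M J′
    M≡J′ = meet-resp {w = J′} T₀≡T₁ meet₀ (meet-of-⊑ J′⊑T₁)
    J′₋≡J′ : R J′₋ J′
    J′₋≡J′ = join-resp {w = J′₋} M≡J′ (join-of-⊑ M⊑J′₋) (join-of-⊒ J′₋⊑J′)

fuel-left : ∀ {f k l m} → m ℕ.< k → k ℕ.≤ suc f + l → m ℕ.≤ f + l
fuel-left m<k k≤ = ℕₚ.≤-pred (ℕₚ.<-≤-trans m<k k≤)

fuel-right : ∀ {f k l m} → l ℕ.< m → k ℕ.≤ suc f + l → k ℕ.≤ f + m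
fuel-right {f} {k} {l} {m} l<m k≤ = ℕₚ.≤-trans k≤ (ℕₚ.≤-trans (ℕₚ.≤-reflexive (sym (ℕₚ.+-suc f l))) (ℕₚ.+-monoʳ-≤ f l<m))

crossing : ∀ {P : ℕ → Set} → U.Decidable P → ∀ {i} j → i ℕ.≤ j → P i → ¬ P j →
           ∃ λ k → i ℕ.≤ k × k ℕ.< j × P k × ¬ P (suc k)
crossing P? zero ℕ.z≤n Pi ¬Pj = ⊥-elim (¬Pj Pi)
crossing P? (suc j) i≤1+j Pi ¬P1+j with ℕₚ.m≤n⇒m<n∨m≡n i≤1+j
... | inj₂ refl = ⊥-elim (¬P1+j Pi)
... | inj₁ i<1+j with P? j
...   | yes Pj = j , ℕₚ.≤-pred i<1+j , ℕₚ.≤-refl , Pj , ¬P1+j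
...   | no ¬Pj = Product.map₂ (Product.map₂ (Product.map₁ ℕₚ.m≤n⇒m≤1+n)) (crossing P? j (ℕₚ.≤-pred i<1+j) Pi ¬Pj)

module _ {n : ℕ} {P : Fin n → Set} (P? : U.Decidable P) (a c : Fin n) where

  private
    Above Below : ℕ → Set
    Above k = ∃ λ b → k ℕ.≤ toℕ b × a < b × b < c × P b
    Below k = ∃ λ b → toℕ b ℕ.< k × a < b × b < c × P b

    Above? : U.Decidable Above
    Above? k = Finₚ.any? (λ b → k ℕ.≤? toℕ b ×-dec a <? b ×-dec b <? c ×-dec P? b)

    Below? : U.Decidable Below
    Below? k = Finₚ.any? (λ b → toℕ b ℕ.<? k ×-dec a <? b ×-dec b <? c ×-dec P? b)

  greatest-in : (∀ {b} → a < b → b < c → ¬ P b) ⊎ ∃ λ b → a < b × b < c × P b × (∀ {b′} → b < b′ → b′ < c → ¬ P b′)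
  greatest-in with Finₚ.any? (λ b → a <? b ×-dec b <? c ×-dec P? b)
  ... | no none = inj₁ (λ a<b b<c Pb → none (_ , a<b , b<c , Pb))
  ... | yes (b₀ , a<b₀ , b₀<c , Pb₀)
    with crossing Above? (toℕ c) (ℕₚ.<⇒≤ b₀<c) (b₀ , ℕₚ.≤-refl , a<b₀ , b₀<c , Pb₀)
                  (λ { (b , c≤b , _ , b<c , _) → ℕₚ.<⇒≱ b<c c≤b })
  ... | k , _ , _ , (b , k≤b , a<b , b<c , Pb) , ¬above =
    inj₂ (b , a<b , b<c , Pb , λ {b′} b<b′ b′<c Pb′ →
      ¬above (b′ , ℕₚ.≤-trans (ℕ.s≤s k≤b) b<b′ , Finₚ.<-trans a<b b<b′ , b′<c , Pb′))

  -- The least witness is where "no witness below k" stops holding.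
  least-in : (∀ {b} → a < b → b < c → ¬ P b) ⊎ ∃ λ b → a < b × b < c × P b × (∀ {b′} → a < b′ → b′ < b → ¬ P b′)
  least-in with Finₚ.any? (λ b → a <? b ×-dec b <? c ×-dec P? b)
  ... | no none = inj₁ (λ a<b b<c Pb → none (_ , a<b , b<c , Pb))
  ... | yes (b₀ , a<b₀ , b₀<c , Pb₀)
    with crossing (¬? ∘ Below?) (toℕ c) (Finₚ.<-trans a<b₀ b₀<c) (λ { (b , b≤a , a<b , _) → ℕₚ.<⇒≱ a<b (ℕₚ.≤-pred b≤a) })
                  (λ none → none (b₀ , b₀<c , a<b₀ , b₀<c , Pb₀))
  ... | k , _ , _ , ¬below-k , ¬¬below-1+k with decidable-stable (Below? (suc k)) ¬¬below-1+k
  ...   | b , b<1+k , a<b , b<c , Pb =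
    inj₂ (b , a<b , b<c , Pb , λ {b′} a<b′ b′<b Pb′ →
      ¬below-k (b′ , ℕₚ.<-≤-trans b′<b (ℕₚ.≤-pred b<1+k) , a<b′ , Finₚ.<-trans b′<b b<c , Pb′))

injective⇒surjective : ∀ {n} (h : Fin n → Fin n) → (∀ {u v} → h u ≡ h v → u ≡ v) → ∀ i → ∃ λ v → h v ≡ i
injective⇒surjective {suc m} h h-injective i with Finₚ.any? (λ v → h v Fin.≟ i)
... | yes hit = hit
... | no miss = ⊥-elim (ℕₚ.<-irrefl refl (Finₚ.injective⇒≤ g-injective))
  where
  i≢h : ∀ v → i ≢ h v
  i≢h v e = miss (v , sym e)
  g : Fin (suc m) → Fin m
  g v = Fin.punchOut (i≢h v)
  g-injective : ∀ {u v} → g u ≡ g v → u ≡ v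
  g-injective e = h-injective (Finₚ.punchOut-injective (i≢h _) (i≢h _) e)

-- Fin n listed by increasing f: v goes to position ∣ {u ∣ f u < f v} ∣.
module Sort {n : ℕ} (f : Fin n → ℕ) (f-injective : ∀ {u v} → f u ≡ f v → u ≡ v) where

  private
    smaller : Fin n → Subset n
    smaller v = tabulate (λ u → does (f u ℕ.<? f v))

    ∈-smaller : ∀ {u v} → f u ℕ.< f v → u ∈ smaller v
    ∈-smaller {u} {v} p = lookup⇒[]= u (smaller v) (trans (lookup∘tabulate _ u) (dec-true (f u ℕ.<? f v) p))

    ∈-smaller⁻ : ∀ {u v} → u ∈ smaller v → f u ℕ.< f v
    ∈-smaller⁻ {u} {v} u∈ = ℕₚ.<ᵇ⇒< (f u) (f v) (Equivalence.from T-≡ (trans (sym (lookup∘tabulate _ u)) ([]=⇒lookup u∈)))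

    ∉-smaller : ∀ v → ¬ v ∈ smaller v
    ∉-smaller v v∈ = ℕₚ.<-irrefl refl (∈-smaller⁻ v∈)

    rank< : ∀ v → ∣ smaller v ∣ ℕ.< n
    rank< v = subst (∣ smaller v ∣ ℕ.<_) (∣⊤∣≡n n) (p⊂q⇒∣p∣<∣q∣ ((λ _ → ∈⊤) , v , ∈⊤ , ∉-smaller v))

    rank : Fin n → Fin n
    rank v = fromℕ< (rank< v)

    rank-mono : ∀ {u v} → f u ℕ.< f v → rank u < rank v
    rank-mono {u} {v} p =
      subst₂ ℕ._<_ (sym (Finₚ.toℕ-fromℕ< (rank< u))) (sym (Finₚ.toℕ-fromℕ< (rank< v)))
        (p⊂q⇒∣p∣<∣q∣ ((λ w∈ → ∈-smaller (ℕₚ.<-trans (∈-smaller⁻ w∈) p)) , u , ∈-smaller p , ∉-smaller u))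

    rank-injective : ∀ {u v} → rank u ≡ rank v → u ≡ v
    rank-injective {u} {v} e with ℕₚ.<-cmp (f u) (f v)
    ... | tri< p _ _ = ⊥-elim (Finₚ.<-irrefl e (rank-mono p))
    ... | tri≈ _ q _ = f-injective q
    ... | tri> _ _ p = ⊥-elim (Finₚ.<-irrefl (sym e) (rank-mono p))

    unrank : Fin n → Fin n
    unrank i = proj₁ (injective⇒surjective rank rank-injective i)

    rank-unrank : ∀ i → rank (unrank i) ≡ i
    rank-unrank i = proj₂ (injective⇒surjective rank rank-injective i)

  sorted : Perm n
  sorted = permutation unrank rank (λ v → rank-injective (rank-unrank (rank v))) rank-unrank

  Before-sorted : ∀ {u v} → f u ℕ.< f v → Before sorted u v
  Before-sorted = rank-mono

  Before-sorted⁻ : ∀ {u v} → Before sorted u v → f u ℕ.< f v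
  Before-sorted⁻ {u} {v} p with ℕₚ.<-cmp (f u) (f v)
  ... | tri< q _ _ = q
  ... | tri≈ _ q _ = ⊥-elim (Finₚ.<-irrefl (cong rank (f-injective q)) p)
  ... | tri> _ _ q = ⊥-elim (Finₚ.<-asym p (rank-mono q))

module _ {n : ℕ} (κ : Fin n → ℕ) where

  -- The lexicographic order on (κ v , v), encoded in ℕ.
  private
    key : Fin n → ℕ
    key v = κ v * n + toℕ v

    key-< : ∀ {u v} → κ u ℕ.< κ v → key u ℕ.< key v
    key-< {u} {v} p = begin-strict
        κ u * n + toℕ u   <⟨ ℕₚ.+-monoʳ-< (κ u * n) (Finₚ.toℕ<n u) ⟩
        κ u * n + n       ≡⟨ ℕₚ.+-comm (κ u * n) n ⟩
        suc (κ u) * n     ≤⟨ ℕₚ.*-monoˡ-≤ n p ⟩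
        κ v * n           ≤⟨ ℕₚ.m≤m+n (κ v * n) (toℕ v) ⟩
        κ v * n + toℕ v   ∎
      where open ℕₚ.≤-Reasoning

    key-injective : ∀ {u v} → key u ≡ key v → u ≡ v
    key-injective {u} {v} e with ℕₚ.<-cmp (κ u) (κ v)
    ... | tri< p _ _ = ⊥-elim (ℕₚ.<-irrefl e (key-< p))
    ... | tri> _ _ p = ⊥-elim (ℕₚ.<-irrefl (sym e) (key-< p))
    ... | tri≈ _ q _ rewrite q = Finₚ.toℕ-injective (ℕₚ.+-cancelˡ-≡ (κ v * n) _ _ e)

    key-tie : ∀ {u v} → κ u ≡ κ v → u < v → key u ℕ.< key v
    key-tie {u} {v} q u<v rewrite q = ℕₚ.+-monoʳ-< (κ v * n) u<v

  -- Opaque: only its inversions matter, and letting unification unfold it is prohibitively slow.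
  opaque
    byKey : Perm n
    byKey = Sort.sorted key key-injective

    byKey-Inversion : ∀ {a c} → a < c → κ c ℕ.< κ a → Inversion byKey a c
    byKey-Inversion a<c p = inversion a<c (Sort.Before-sorted key key-injective (key-< p))

    byKey-Inversion⁻ : ∀ {a c} → Inversion byKey a c → κ c ℕ.< κ a
    byKey-Inversion⁻ {a} {c} (inversion a<c ca) with ℕₚ.<-cmp (κ c) (κ a)
    ... | tri< p _ _ = p
    ... | tri≈ _ q _ = ⊥-elim (ℕₚ.<-asym (Sort.Before-sorted⁻ key key-injective ca) (key-tie (sym q) a<c))
    ... | tri> _ _ p = ⊥-elim (ℕₚ.<-asym (Sort.Before-sorted⁻ key key-injective ca) (key-< p))

byKey-cong : ∀ {n} {κ₁ κ₂ : Fin n → ℕ} → (∀ v → κ₁ v ≡ κ₂ v) → byKey κ₁ ⊑ byKey κ₂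
byKey-cong {κ₁ = κ₁} {κ₂} e {a} {c} i@(inversion a<c _) =
  byKey-Inversion κ₂ a<c (subst₂ ℕ._<_ (e c) (e a) (byKey-Inversion⁻ κ₁ i))

module _ {n : ℕ} where

  transpose-i : ∀ (i j : Fin n) → PC.transpose i j i ≡ j
  transpose-i i j with i Fin.≟ i
  ... | yes _ = refl
  ... | no i≢i = ⊥-elim (i≢i refl)

  transpose-j : ∀ (i j : Fin n) → PC.transpose i j j ≡ i
  transpose-j i j with j Fin.≟ i
  ... | yes j≡i = j≡i
  ... | no _ with j Fin.≟ j
  ...   | yes _ = refl
  ...   | no j≢j = ⊥-elim (j≢j refl)

  transpose-other : ∀ (i j : Fin n) {k} → k ≢ i → k ≢ j → PC.transpose i j k ≡ k
  transpose-other i j {k} k≢i k≢j with k Fin.≟ i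
  ... | yes k≡i = ⊥-elim (k≢i k≡i)
  ... | no _ with k Fin.≟ j
  ...   | yes k≡j = ⊥-elim (k≢j k≡j)
  ...   | no _ = refl

  -- Equality decided through toℕ, so that `with` does not abstract the tests inside PC.transpose.
  private
    _≟ᵗ_ : (i j : Fin n) → Dec (i ≡ j)
    i ≟ᵗ j = Dec.map′ Finₚ.toℕ-injective (cong toℕ) (toℕ i ℕ.≟ toℕ j)

  transpose-adjacent-< : ∀ {P Q i j : Fin n} → toℕ Q ≡ suc (toℕ P) → i < j → ¬ (i ≡ P × j ≡ Q) →
                         PC.transpose Q P i < PC.transpose Q P j
  transpose-adjacent-< {P} {Q} {i} {j} Q≡1+P i<j ¬PQ with i ≟ᵗ P | i ≟ᵗ Q
  ... | yes refl | _ = subst₂ _<_ (sym (transpose-j Q P)) (sym (transpose-other Q P j≢Q j≢P)) Q<j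
    where
    j≢P : j ≢ P
    j≢P e = Finₚ.<⇒≢ i<j (sym e)
    j≢Q : j ≢ Q
    j≢Q e = ¬PQ (refl , e)
    Q<j : Q < j
    Q<j = ℕₚ.≤∧≢⇒< (subst (ℕ._≤ toℕ j) (sym Q≡1+P) i<j) (λ e → j≢Q (Finₚ.toℕ-injective (sym e)))
  ... | no _ | yes refl =
    subst₂ _<_ (sym (transpose-i Q P)) (sym (transpose-other Q P (Finₚ.<⇒≢ i<j ∘ sym) (λ e → Finₚ.<-asym i<j (subst (_< i) (sym e) P<Q))))
      (Finₚ.<-trans P<Q i<j)
    where
    P<Q : P < Q
    P<Q = subst (toℕ P ℕ.<_) (sym Q≡1+P) (ℕₚ.n<1+n _)
  ... | no i≢P | no i≢Q with j ≟ᵗ P | j ≟ᵗ Q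
  ...   | yes refl | _ =
    subst₂ _<_ (sym (transpose-other Q P i≢Q i≢P)) (sym (transpose-j Q P)) (Finₚ.<-trans i<j (subst (toℕ P ℕ.<_) (sym Q≡1+P) (ℕₚ.n<1+n _)))
  ...   | no _ | yes refl =
    subst₂ _<_ (sym (transpose-other Q P i≢Q i≢P)) (sym (transpose-i Q P))
      (ℕₚ.≤∧≢⇒< (ℕₚ.≤-pred (subst (toℕ i ℕ.<_) Q≡1+P i<j)) (λ e → i≢P (Finₚ.toℕ-injective e)))
  ...   | no j≢P | no j≢Q = subst₂ _<_ (sym (transpose-other Q P i≢Q i≢P)) (sym (transpose-other Q P j≢Q j≢P)) i<j

  adjacent-or-between : ∀ x {u v} → Before x u v →
                        toℕ (pos x v) ≡ suc (toℕ (pos x u)) ⊎ ∃ λ w → Before x u w × Before x w v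
  adjacent-or-between x {u} {v} uv with toℕ (pos x v) ℕ.≟ suc (toℕ (pos x u))
  ... | yes adj = inj₁ adj
  ... | no ¬adj = inj₂ (w , subst (toℕ (pos x u) ℕ.<_) (sym pos-w) (ℕₚ.n<1+n _) , subst (ℕ._< toℕ (pos x v)) (sym pos-w) next<v)
    where
    next<v : suc (toℕ (pos x u)) ℕ.< toℕ (pos x v)
    next<v = ℕₚ.≤∧≢⇒< uv (¬adj ∘ sym)
    w : Fin n
    w = x ⟨$⟩ʳ fromℕ< (ℕₚ.<-trans next<v (Finₚ.toℕ<n (pos x v)))
    pos-w : toℕ (pos x w) ≡ suc (toℕ (pos x u))
    pos-w = trans (cong toℕ (inverseˡ x)) (Finₚ.toℕ-fromℕ< _)

module AdjacentSwap {n : ℕ} (x : Perm n) {u v : Fin n} (k : ℕ) (k+1<n : suc k ℕ.< n)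
                    (pos-u : toℕ (pos x u) ≡ k) (pos-v : toℕ (pos x v) ≡ suc k) where

  swapped : Perm n
  swapped = x · sref k k+1<n

  -- pos swapped w reduces to PC.transpose Q P (pos x w).
  private
    P Q : Fin n
    P = fromℕ< (ℕₚ.<-trans (ℕₚ.n<1+n k) k+1<n)
    Q = fromℕ< k+1<n

    pos-u≡P : pos x u ≡ P
    pos-u≡P = Finₚ.toℕ-injective (trans pos-u (sym (Finₚ.toℕ-fromℕ< _)))

    pos-v≡Q : pos x v ≡ Q
    pos-v≡Q = Finₚ.toℕ-injective (trans pos-v (sym (Finₚ.toℕ-fromℕ< _)))

    Q≡1+P : toℕ Q ≡ suc (toℕ P)
    Q≡1+P = trans (Finₚ.toℕ-fromℕ< _) (cong suc (sym (Finₚ.toℕ-fromℕ< _)))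

  swap-preserves : ∀ {a b} → ¬ (a ≡ u × b ≡ v) → Before x a b → Before swapped a b
  swap-preserves ¬uv ab = transpose-adjacent-< Q≡1+P ab
    (λ { (a↦P , b↦Q) → ¬uv (pos-injective x (trans a↦P (sym pos-u≡P)) , pos-injective x (trans b↦Q (sym pos-v≡Q))) })

  swap-reflects : ∀ {a b} → ¬ (a ≡ v × b ≡ u) → Before swapped a b → Before x a b
  swap-reflects {a} {b} ¬vu ab with a Fin.≟ b
  ... | yes refl = ⊥-elim (Finₚ.<-irrefl refl ab)
  ... | no a≢b with Before-total x a≢b
  ...   | inj₁ p = p
  ...   | inj₂ ba = ⊥-elim (Finₚ.<-asym ab (swap-preserves (λ { (b≡u , a≡v) → ¬vu (a≡v , b≡u) }) ba))

  u-before-v : Before x u v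
  u-before-v = subst₂ ℕ._<_ (sym pos-u) (sym pos-v) (ℕₚ.n<1+n k)

  v-before-u : Before swapped v u
  v-before-u = subst₂ _<_ (sym (trans (cong (PC.transpose Q P) pos-v≡Q) (transpose-i Q P)))
                          (sym (trans (cong (PC.transpose Q P) pos-u≡P) (transpose-j Q P)))
                          (subst (toℕ P ℕ.<_) (sym Q≡1+P) (ℕₚ.n<1+n _))

  module Descent (v<u : v < u) where

    descent-⊑ : swapped ⊑ x
    descent-⊑ (inversion a<b ba) =
      inversion a<b (swap-reflects (λ { (refl , refl) → Finₚ.<-asym a<b v<u }) ba)

    descent-keeps : ∀ {a b} → Inversion x a b → ¬ (a ≡ v × b ≡ u) → Inversion swapped a b
    descent-keeps (inversion a<b ba) ¬vu = inversion a<b (swap-preserves (λ { (b≡u , a≡v) → ¬vu (a≡v , b≡u) }) ba)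

    descent-Inversion : Inversion x v u
    descent-Inversion = inversion v<u u-before-v

    descent-removes : ¬ Inversion swapped v u
    descent-removes (inversion _ uv) = Finₚ.<-asym uv v-before-u

  module Ascent (u<v : u < v) where

    ascent-⊑ : x ⊑ swapped
    ascent-⊑ (inversion a<b ba) =
      inversion a<b (swap-preserves (λ { (refl , refl) → Finₚ.<-asym a<b u<v }) ba)

    ascent-keeps : ∀ {a b} → Inversion swapped a b → ¬ (a ≡ u × b ≡ v) → Inversion x a b
    ascent-keeps (inversion a<b ba) ¬uv = inversion a<b (swap-reflects (λ { (b≡v , a≡u) → ¬uv (a≡u , b≡v) }) ba)

    ascent-Inversion⁻ : ∀ {a b} → Inversion swapped a b → Inversion x a b ⊎ (a ≡ u × b ≡ v)
    ascent-Inversion⁻ {a} {b} i with a Fin.≟ u | b Fin.≟ v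
    ... | yes a≡u | yes b≡v = inj₂ (a≡u , b≡v)
    ... | no a≢u | _ = inj₁ (ascent-keeps i (a≢u ∘ proj₁))
    ... | yes _ | no b≢v = inj₁ (ascent-keeps i (b≢v ∘ proj₂))

    ascent-Inversion : Inversion swapped u v
    ascent-Inversion = inversion u<v v-before-u

    ascent-new : ¬ Inversion x u v
    ascent-new (inversion _ vu) = Finₚ.<-asym vu u-before-v

module _ {n : ℕ} where

  record Straddle (x : Perm n) (b : Fin n) (i j : ℕ) : Set where
    field
      k     : ℕ
      k+1<n : suc k ℕ.< n
      {u v} : Fin n
      pos-u : toℕ (pos x u) ≡ k
      pos-v : toℕ (pos x v) ≡ suc k
      i≤k   : i ℕ.≤ k
      k<j   : k ℕ.< j
      v<b   : v < b
      b<u   : b < u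

  -- Between an entry c > b and a later entry a < b there is an adjacent descent across b.
  straddle : ∀ x {a b c : Fin n} → a < b → b < c → Before x c a → Before x b c ⊎ Before x a b →
             Straddle x b (toℕ (pos x c)) (toℕ (pos x a))
  straddle x {a} {b} {c} a<b b<c ca b-outside
    with crossing Above? (toℕ (pos x a)) (ℕₚ.<⇒≤ ca) (c , refl , b<c)
                  (λ { (w , w↦a , b<w) → Finₚ.<-asym a<b (subst (b <_) (located-a w↦a) b<w) })
    where
    Above : ℕ → Set
    Above k = ∃ λ w → toℕ (pos x w) ≡ k × b < w
    Above? : U.Decidable Above
    Above? k = Finₚ.any? (λ w → toℕ (pos x w) ℕ.≟ k ×-dec b <? w)
    located-a : ∀ {w} → toℕ (pos x w) ≡ toℕ (pos x a) → w ≡ a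
    located-a e = pos-injective x (Finₚ.toℕ-injective e)
  ... | k , c≤k , k<a , (u , pos-u , b<u) , ¬above = record
    { k = k ; k+1<n = k+1<n ; pos-u = pos-u ; pos-v = pos-v ; i≤k = c≤k ; k<j = k<a ; v<b = v<b ; b<u = b<u }
    where
    k+1<n : suc k ℕ.< n
    k+1<n = ℕₚ.≤-<-trans k<a (Finₚ.toℕ<n (pos x a))
    v : Fin n
    v = x ⟨$⟩ʳ fromℕ< k+1<n
    pos-v : toℕ (pos x v) ≡ suc k
    pos-v = trans (cong toℕ (inverseˡ x)) (Finₚ.toℕ-fromℕ< _)
    v≢b : v ≢ b
    v≢b v≡b = Sum.[ (λ bc → ℕₚ.<-asym (ℕₚ.<-≤-trans (subst (ℕ._< toℕ (pos x c)) pos-b bc) c≤k) (ℕₚ.n<1+n k))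
                  , (λ ab → ℕₚ.<⇒≱ (subst (toℕ (pos x a) ℕ.<_) pos-b ab) k<a) ] b-outside
      where
      pos-b : toℕ (pos x b) ≡ suc k
      pos-b = trans (cong (toℕ ∘ pos x) (sym v≡b)) pos-v
    v<b : v < b
    v<b with Finₚ.<-cmp v b
    ... | tri< v<b _ _ = v<b
    ... | tri≈ _ v≡b _ = ⊥-elim (v≢b v≡b)
    ... | tri> _ _ b<v = ⊥-elim (¬above (v , pos-v , b<v))

module _ {n : ℕ} {U V : Fin n → Fin n → Set} where

  chain-map : (∀ {a b} → U a b → V a b) → ∀ {a c} → TransClosure U a c → TransClosure V a c
  chain-map f [ u ] = [ f u ]
  chain-map f (u ∷ r) = f u ∷ chain-map f r

module _ {n : ℕ} {U : Fin n → Fin n → Set} where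

  chain-unsnoc : ∀ {a c} → TransClosure U a c → U a c ⊎ ∃ λ t → TransClosure U a t × U t c
  chain-unsnoc [ u ] = inj₁ u
  chain-unsnoc (u ∷ r) with chain-unsnoc r
  ... | inj₁ u′ = inj₂ (_ , [ u ] , u′)
  ... | inj₂ (t , r′ , u′) = inj₂ (t , u ∷ r′ , u′)

module Chains {n : ℕ} {U : Fin n → Fin n → Set}
              (U-cotrans : ∀ {a b c} → a < b → b < c → U a c → U a b ⊎ U b c) where

  chain-cotrans : ∀ {a b c} → a < b → b < c → TransClosure U a c → TransClosure U a b ⊎ TransClosure U b c
  chain-cotrans a<b b<c [ u ] with U-cotrans a<b b<c u
  ... | inj₁ u′ = inj₁ [ u′ ]
  ... | inj₂ u′ = inj₂ [ u′ ]
  chain-cotrans {b = b} a<b b<c (_∷_ {y = t} u r) with Finₚ.<-cmp b t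
  ... | tri≈ _ refl _ = inj₁ [ u ]
  ... | tri< b<t _ _ with U-cotrans a<b b<t u
  ...   | inj₁ u′ = inj₁ [ u′ ]
  ...   | inj₂ u′ = inj₂ (u′ ∷ r)
  chain-cotrans a<b b<c (u ∷ r) | tri> _ _ t<b with chain-cotrans t<b b<c r
  ...   | inj₁ r′ = inj₁ (u ∷ r′)
  ...   | inj₂ r′ = inj₂ r′

  -- By induction on ρ a − ρ c: a point w strictly between in ρ is attached by cotransitivity.
  module _ (ρ : Fin n → ℕ) (sound : ∀ {a c} → TransClosure U a c → ρ c ℕ.< ρ a)
           (split : ∀ {a c} → a < c → ρ c ℕ.< ρ a → U a c ⊎ ∃ λ w → ρ c ℕ.< ρ w × ρ w ℕ.< ρ a) where

    private
      chain′ : ∀ f {a c} → ρ a ℕ.≤ f + ρ c → a < c → ρ c ℕ.< ρ a → TransClosure U a c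
      chain′ zero le _ ca = ⊥-elim (ℕₚ.<-irrefl refl (ℕₚ.<-≤-trans ca le))
      chain′ (suc f) {a} {c} le a<c ca with split a<c ca
      ... | inj₁ u = [ u ]
      ... | inj₂ (w , cw , wa) = through (Finₚ.<-cmp w a) (Finₚ.<-cmp w c)
        where
        w⇝c : w < c → TransClosure U w c
        w⇝c w<c = chain′ f (fuel-left {f} wa le) w<c cw
        a⇝w : a < w → TransClosure U a w
        a⇝w a<w = chain′ f (fuel-right {f} cw le) a<w wa
        through : Tri (w < a) (w ≡ a) (a < w) → Tri (w < c) (w ≡ c) (c < w) → TransClosure U a c
        through (tri≈ _ w≡a _) _ = ⊥-elim (ℕₚ.<-irrefl (cong ρ w≡a) wa)
        through _ (tri≈ _ w≡c _) = ⊥-elim (ℕₚ.<-irrefl (cong ρ (sym w≡c)) cw)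
        through (tri< w<a _ _) _ with chain-cotrans w<a a<c (w⇝c (Finₚ.<-trans w<a a<c))
        ... | inj₁ w⇝a = ⊥-elim (ℕₚ.<-asym wa (sound w⇝a))
        ... | inj₂ a⇝c = a⇝c
        through (tri> _ _ a<w) (tri< w<c _ _) = a⇝w a<w ++ w⇝c w<c
        through (tri> _ _ a<w) (tri> _ _ c<w) with chain-cotrans a<c c<w (a⇝w a<w)
        ... | inj₁ a⇝c = a⇝c
        ... | inj₂ c⇝w = ⊥-elim (ℕₚ.<-asym cw (sound c⇝w))

    chain : ∀ {a c} → a < c → ρ c ℕ.< ρ a → TransClosure U a c
    chain {a} {c} = chain′ (ρ a) (ℕₚ.m≤m+n (ρ a) (ρ c))

module _ {n : ℕ} where

  EitherInversion EitherNonInversion : Perm n → Perm n → Fin n → Fin n → Set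
  EitherInversion x y a c = Inversion x a c ⊎ Inversion y a c
  EitherNonInversion x y a c = NonInversion x a c ⊎ NonInversion y a c

module _ {n : ℕ} {x y j : Perm n} (J : IsJoin x y j) where

  private
    open JoinOf {x = x} {y} {j} J

    cotrans : ∀ {a b c} → a < b → b < c → EitherInversion x y a c → EitherInversion x y a b ⊎ EitherInversion x y b c
    cotrans a<b b<c (inj₁ i) = Sum.map inj₁ inj₁ (Inversion-cotrans x a<b b<c i)
    cotrans a<b b<c (inj₂ i) = Sum.map inj₂ inj₂ (Inversion-cotrans y a<b b<c i)

    open Chains cotrans

    -- Otherwise j with its adjacent descent c a undone would still lie above x and y.
    adjacent : ∀ {a c} → a < c → toℕ (pos j a) ≡ suc (toℕ (pos j c)) → ¬ ¬ EitherInversion x y a c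
    adjacent {a} {c} a<c adj ¬xy = descent-removes (least (keep upperˡ inj₁) (keep upperʳ inj₂) descent-Inversion)
      where
      open AdjacentSwap j {c} {a} (toℕ (pos j c)) (subst (ℕ._< n) adj (Finₚ.toℕ<n (pos j a))) refl adj
      open Descent a<c
      keep : ∀ {w} → w ⊑ j → (∀ {s t} → Inversion w s t → EitherInversion x y s t) → w ⊑ swapped
      keep w⊑j either i = descent-keeps (w⊑j i) (λ { (s≡a , t≡c) → ¬xy (subst₂ (EitherInversion x y) s≡a t≡c (either i)) })

  join-chain⁻ : ∀ {a c} → TransClosure (EitherInversion x y) a c → Inversion j a c
  join-chain⁻ = transitive⁻ (Inversion j) (Inversion-trans j) ∘ chain-map Sum.[ upperˡ , upperʳ ]

  join-chain : ∀ {a c} → Inversion j a c → TransClosure (EitherInversion x y) a c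
  join-chain {a} {c} (inversion a<c ca) = chain (toℕ ∘ pos j) (Inversion.flipped ∘ join-chain⁻) split a<c ca
    where
    split : ∀ {a c} → a < c → Before j c a → EitherInversion x y a c ⊎ ∃ λ w → Before j c w × Before j w a
    split {a} {c} a<c ca with adjacent-or-between j ca
    ... | inj₂ between = inj₂ between
    ... | inj₁ adj with Inversion? x a c ⊎-dec Inversion? y a c
    ...   | yes xy = inj₁ xy
    ...   | no ¬xy = ⊥-elim (adjacent a<c adj ¬xy)

module _ {n : ℕ} {x y m : Perm n} (M : IsMeet x y m) where

  private
    open MeetOf {x = x} {y} {m} M

    cotrans : ∀ {a b c} → a < b → b < c → EitherNonInversion x y a c → EitherNonInversion x y a b ⊎ EitherNonInversion x y b c
    cotrans a<b b<c (inj₁ i) = Sum.map inj₁ inj₁ (NonInversion-cotrans x a<b b<c i)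
    cotrans a<b b<c (inj₂ i) = Sum.map inj₂ inj₂ (NonInversion-cotrans y a<b b<c i)

    open Chains cotrans

    -- Reversing the positions of m turns its non-inversions into pairs with ρ c < ρ a.
    ρ : Fin n → ℕ
    ρ v = n ∸ toℕ (pos m v)

    ρ-< : ∀ {a c} → Before m a c → ρ c ℕ.< ρ a
    ρ-< {a} {c} ac = ℕₚ.∸-monoʳ-< ac (ℕₚ.<⇒≤ (Finₚ.toℕ<n (pos m c)))

    ρ-<⁻ : ∀ {a c} → ρ c ℕ.< ρ a → Before m a c
    ρ-<⁻ {a} {c} ca with Finₚ.<-cmp (pos m a) (pos m c)
    ... | tri< ac _ _ = ac
    ... | tri≈ _ e _ = ⊥-elim (ℕₚ.<-irrefl (cong (λ i → n ∸ toℕ i) (sym e)) ca)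
    ... | tri> _ _ c<a = ⊥-elim (ℕₚ.<-asym ca (ρ-< c<a))

    -- Otherwise m with its adjacent ascent a c reversed would still lie below x and y.
    adjacent : ∀ {a c} → a < c → toℕ (pos m c) ≡ suc (toℕ (pos m a)) → ¬ ¬ EitherNonInversion x y a c
    adjacent {a} {c} a<c adj ¬xy = ascent-new (greatest (lift x inj₁ lowerˡ) (lift y inj₂ lowerʳ) ascent-Inversion)
      where
      open AdjacentSwap m {a} {c} (toℕ (pos m a)) (subst (ℕ._< n) adj (Finₚ.toℕ<n (pos m c))) refl adj
      open Ascent a<c
      lift : ∀ w → (NonInversion w a c → EitherNonInversion x y a c) → m ⊑ w → swapped ⊑ w
      lift w either m⊑w {s} {t} i with s Fin.≟ a | t Fin.≟ c
      ... | yes refl | yes refl = ¬NonInversion⇒Inversion w a<c (¬xy ∘ either)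
      ... | no s≢a | _ = m⊑w (ascent-keeps i (s≢a ∘ proj₁))
      ... | yes _ | no t≢c = m⊑w (ascent-keeps i (t≢c ∘ proj₂))

  meet-chain⁻ : ∀ {a c} → TransClosure (EitherNonInversion x y) a c → NonInversion m a c
  meet-chain⁻ = transitive⁻ (NonInversion m) (NonInversion-trans m) ∘ chain-map Sum.[ ⊑⇒NonInversion lowerˡ , ⊑⇒NonInversion lowerʳ ]

  meet-chain : ∀ {a c} → NonInversion m a c → TransClosure (EitherNonInversion x y) a c
  meet-chain (noninversion a<c ac) = chain ρ (ρ-< ∘ NonInversion.kept ∘ meet-chain⁻) split a<c (ρ-< ac)
    where
    split : ∀ {a c} → a < c → ρ c ℕ.< ρ a → EitherNonInversion x y a c ⊎ ∃ λ w → ρ c ℕ.< ρ w × ρ w ℕ.< ρ a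
    split {a} {c} a<c ca with adjacent-or-between m (ρ-<⁻ ca)
    ... | inj₂ (w , aw , wc) = inj₂ (w , ρ-< wc , ρ-< aw)
    ... | inj₁ adj with NonInversion? x a c ⊎-dec NonInversion? y a c
    ...   | yes xy = inj₁ xy
    ...   | no ¬xy = ⊥-elim (adjacent a<c adj ¬xy)

prove< : ∀ {m k} → True (m ℕ.<? k) → m ℕ.< k
prove< = toWitness

refute≤ : ∀ {m k} → False (m ℕ.≤? k) → ¬ m ℕ.≤ k
refute≤ = toWitnessFalse

if-elim : ∀ (P : ℕ → Set) top {k₁ k₂} → P k₁ → P k₂ → P (if top then k₁ else k₂)
if-elim P true p₁ _ = p₁
if-elim P false _ p₂ = p₂

arcKey : Bool → ℕ → Bool → ℕ
arcKey _   0 _    = 0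
arcKey top 1 _    = if top then 2 else 1
arcKey _   2 l    = if l then 0 else 3
arcKey top 3 _    = if top then 1 else 2
arcKey _   _ _    = 3

module _ {n : ℕ} where

  zoneOf : Fin n → Fin n → ℕ
  zoneOf b v with Finₚ.<-cmp b v
  ... | tri< _ _ _ = 2
  ... | tri≈ _ _ _ = 1
  ... | tri> _ _ _ = 0

  zoneOf-< : ∀ {b v : Fin n} → b < v → zoneOf b v ≡ 2
  zoneOf-< {b} {v} b<v with Finₚ.<-cmp b v
  ... | tri< _ _ _ = refl
  ... | tri≈ _ refl _ = ⊥-elim (Finₚ.<-irrefl refl b<v)
  ... | tri> _ _ v<b = ⊥-elim (Finₚ.<-asym b<v v<b)

  zoneOf-self : ∀ (b : Fin n) → zoneOf b b ≡ 1
  zoneOf-self b with Finₚ.<-cmp b b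
  ... | tri< b<b _ _ = ⊥-elim (Finₚ.<-irrefl refl b<b)
  ... | tri≈ _ _ _ = refl
  ... | tri> _ _ b<b = ⊥-elim (Finₚ.<-irrefl refl b<b)

  zoneOf-> : ∀ {b v : Fin n} → v < b → zoneOf b v ≡ 0
  zoneOf-> {b} {v} v<b with Finₚ.<-cmp b v
  ... | tri< b<v _ _ = ⊥-elim (Finₚ.<-asym b<v v<b)
  ... | tri≈ _ refl _ = ⊥-elim (Finₚ.<-irrefl refl v<b)
  ... | tri> _ _ _ = refl

  -- The points bs cut Fin n into zones: zone bs v counts 2 for every point below v and 1 for
  -- the point v itself, so for sorted bs the odd zones are the points and the even ones the gaps.
  zone : List (Fin n) → Fin n → ℕ
  zone [] v = 0
  zone (b ∷ bs) v = zoneOf b v + zone bs v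

  zoneOf-mono : ∀ b {u v} → u Fin.≤ v → zoneOf b u ℕ.≤ zoneOf b v
  zoneOf-mono b {u} {v} u≤v with Finₚ.<-cmp b u | Finₚ.<-cmp b v
  ... | tri> _ _ _ | _ = ℕ.z≤n
  ... | tri≈ _ _ _ | tri< _ _ _ = ℕₚ.n≤1+n 1
  ... | tri≈ _ _ _ | tri≈ _ _ _ = ℕₚ.≤-refl
  ... | tri≈ _ refl _ | tri> _ _ v<u = ⊥-elim (ℕₚ.<-irrefl refl (ℕₚ.<-≤-trans v<u u≤v))
  ... | tri< _ _ _ | tri< _ _ _ = ℕₚ.≤-refl
  ... | tri< b<u _ _ | tri≈ _ refl _ = ⊥-elim (ℕₚ.<-irrefl refl (ℕₚ.<-≤-trans b<u u≤v))
  ... | tri< b<u _ _ | tri> _ _ v<b = ⊥-elim (Finₚ.<-asym b<u (ℕₚ.≤-<-trans u≤v v<b))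

  zone-mono : ∀ bs {u v} → u Fin.≤ v → zone bs u ℕ.≤ zone bs v
  zone-mono [] _ = ℕ.z≤n
  zone-mono (b ∷ bs) u≤v = ℕₚ.+-mono-≤ (zoneOf-mono b u≤v) (zone-mono bs u≤v)

  -- The inversions of the join-irreducible permutation of the arc from a to c that passes each
  -- inner point v on the side L v (true: left), i.e. Reading's arcs.
  data InnerInversion (L : Fin n → Bool) (a c : Fin n) : Fin n → Fin n → Set where
    left  : ∀ {l} → a < l → l < c → L l ≡ true → InnerInversion L a c a l
    right : ∀ {r} → a < r → r < c → L r ≡ false → InnerInversion L a c r c
    cross : ∀ {r l} → a < r → r < l → l < c → L r ≡ false → L l ≡ true → InnerInversion L a c r l

  ArcInversion : (Fin n → Bool) → Fin n → Fin n → Fin n → Fin n → Set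
  ArcInversion L a c u v = (u ≡ a × v ≡ c) ⊎ InnerInversion L a c u v

  -- In one-line notation: the v < a and the inner v with L v; then c a if top, a c otherwise;
  -- then the inner v without L v and the v > c; each block increasing.
  arcPerm : Bool → (Fin n → Bool) → Fin n → Fin n → Perm n
  arcPerm top L a c = byKey (λ v → arcKey top (zone (a ∷ c ∷ []) v) (L v))

  jirr jirr⁻ : (Fin n → Bool) → Fin n → Fin n → Perm n
  jirr = arcPerm true
  jirr⁻ = arcPerm false

  module _ {a c : Fin n} (a<c : a < c) where

    private
      data ArcZone (v : Fin n) : ℕ → Set where
        below  : v < a → ArcZone v 0
        at-a   : v ≡ a → ArcZone v 1
        inside : a < v → v < c → ArcZone v 2
        at-c   : v ≡ c → ArcZone v 3
        above  : c < v → ArcZone v 4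

      arcZone : ∀ v → ArcZone v (zone (a ∷ c ∷ []) v)
      arcZone v with Finₚ.<-cmp a v | Finₚ.<-cmp c v
      ... | tri> _ _ v<a | tri> _ _ _ = below v<a
      ... | tri> _ _ v<a | tri≈ _ refl _ = ⊥-elim (Finₚ.<-asym a<c v<a)
      ... | tri> _ _ v<a | tri< c<v _ _ = ⊥-elim (Finₚ.<-asym a<c (Finₚ.<-trans c<v v<a))
      ... | tri≈ _ a≡v _ | tri> _ _ _ = at-a (sym a≡v)
      ... | tri≈ _ refl _ | tri≈ _ refl _ = ⊥-elim (Finₚ.<-irrefl refl a<c)
      ... | tri≈ _ refl _ | tri< c<v _ _ = ⊥-elim (Finₚ.<-asym a<c c<v)
      ... | tri< a<v _ _ | tri> _ _ v<c = inside a<v v<c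
      ... | tri< _ _ _ | tri≈ _ c≡v _ = at-c (sym c≡v)
      ... | tri< _ _ _ | tri< c<v _ _ = above c<v

      zone₂ : Fin n → ℕ
      zone₂ = zone (a ∷ c ∷ [])

      zone₂-a : zone₂ a ≡ 1
      zone₂-a rewrite zoneOf-self a | zoneOf-> a<c = refl

      zone₂-c : zone₂ c ≡ 3
      zone₂-c rewrite zoneOf-< a<c | zoneOf-self c = refl

      zone₂-inside : ∀ {v} → a < v → v < c → zone₂ v ≡ 2
      zone₂-inside a<v v<c rewrite zoneOf-< a<v | zoneOf-> v<c = refl

      classify : ∀ top L {u v} → u < v → zone₂ u ℕ.≤ zone₂ v →
                 arcKey top (zone₂ v) (L v) ℕ.< arcKey top (zone₂ u) (L u) →
                 (top ≡ true × u ≡ a × v ≡ c) ⊎ InnerInversion L a c u v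
      classify top L {u} {v} u<v hz hk with zone₂ u | arcZone u | zone₂ v | arcZone v | L u in Lu | L v in Lv
      ... | _ | below _ | _ | _ | _ | _ = ⊥-elim (ℕₚ.n≮0 hk)
      ... | _ | at-a refl | _ | below _ | _ | _ = ⊥-elim (refute≤ _ hz)
      ... | _ | at-a refl | _ | at-a refl | _ | _ = ⊥-elim (Finₚ.<-irrefl refl u<v)
      ... | _ | at-a refl | _ | inside a<v v<c | _ | true = inj₂ (left a<v v<c Lv)
      ... | _ | at-a refl | _ | at-c refl | _ | _ = ends top hk
        where
        ends : ∀ top → (if top then 1 else 2) ℕ.< (if top then 2 else 1) → (top ≡ true × a ≡ a × c ≡ c) ⊎ _
        ends true _ = inj₁ (refl , refl , refl)
        ends false 2<1 = ⊥-elim (refute≤ _ 2<1)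
      ... | _ | inside _ _ | _ | _ | true | _ = ⊥-elim (ℕₚ.n≮0 hk)
      ... | _ | inside _ _ | _ | below _ | false | _ = ⊥-elim (refute≤ _ hz)
      ... | _ | inside _ _ | _ | at-a _ | false | _ = ⊥-elim (refute≤ _ hz)
      ... | _ | inside a<u _ | _ | inside _ v<c | false | true = inj₂ (cross a<u u<v v<c Lu Lv)
      ... | _ | inside _ _ | _ | inside _ _ | false | false = ⊥-elim (refute≤ _ hk)
      ... | _ | inside a<u u<c | _ | at-c refl | false | _ = inj₂ (right a<u u<c Lu)
      ... | _ | inside _ _ | _ | above _ | false | _ = ⊥-elim (refute≤ _ hk)
      ... | _ | at-c refl | _ | at-c refl | _ | _ = ⊥-elim (Finₚ.<-irrefl refl u<v)
      ... | _ | above _ | _ | above _ | _ | _ = ⊥-elim (refute≤ _ hk)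
      ... | _ | at-a refl | _ | inside _ _ | _ | false = ⊥-elim (if-elim (λ k → ¬ 3 ℕ.< k) top (refute≤ _) (refute≤ _) hk)
      ... | _ | at-a refl | _ | above _ | _ | _ = ⊥-elim (if-elim (λ k → ¬ 3 ℕ.< k) top (refute≤ _) (refute≤ _) hk)
      ... | _ | at-c refl | _ | above _ | _ | _ = ⊥-elim (if-elim (λ k → ¬ 3 ℕ.< k) top (refute≤ _) (refute≤ _) hk)
      ... | _ | at-c _ | _ | below _ | _ | _ = ⊥-elim (refute≤ _ hz)
      ... | _ | at-c _ | _ | at-a _ | _ | _ = ⊥-elim (refute≤ _ hz)
      ... | _ | at-c _ | _ | inside _ _ | _ | _ = ⊥-elim (refute≤ _ hz)
      ... | _ | above _ | _ | below _ | _ | _ = ⊥-elim (refute≤ _ hz)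
      ... | _ | above _ | _ | at-a _ | _ | _ = ⊥-elim (refute≤ _ hz)
      ... | _ | above _ | _ | inside _ _ | _ | _ = ⊥-elim (refute≤ _ hz)
      ... | _ | above _ | _ | at-c _ | _ | _ = ⊥-elim (refute≤ _ hz)

    module _ (L : Fin n → Bool) where

      arcPerm-Inversion⁻ : ∀ top {u v} → Inversion (arcPerm top L a c) u v →
                           (top ≡ true × u ≡ a × v ≡ c) ⊎ InnerInversion L a c u v
      arcPerm-Inversion⁻ top i@(inversion u<v _) =
        classify top L u<v (zone-mono (a ∷ c ∷ []) (ℕₚ.<⇒≤ u<v)) (byKey-Inversion⁻ _ i)

      arcPerm-Inversion⁺ : ∀ top {u v} → InnerInversion L a c u v → Inversion (arcPerm top L a c) u v
      arcPerm-Inversion⁺ top (left {l} a<l l<c Ll) = byKey-Inversion _ a<l key<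
        where
        key< : arcKey top (zone₂ l) (L l) ℕ.< arcKey top (zone₂ a) (L a)
        key< rewrite zone₂-inside a<l l<c | zone₂-a | Ll = if-elim (0 ℕ.<_) top (prove< _) (prove< _)
      arcPerm-Inversion⁺ top (right {r} a<r r<c Lr) = byKey-Inversion _ r<c key<
        where
        key< : arcKey top (zone₂ c) (L c) ℕ.< arcKey top (zone₂ r) (L r)
        key< rewrite zone₂-inside a<r r<c | zone₂-c | Lr = if-elim (ℕ._< 3) top (prove< _) (prove< _)
      arcPerm-Inversion⁺ top (cross {r} {l} a<r r<l l<c Lr Ll) = byKey-Inversion _ r<l key<
        where
        key< : arcKey top (zone₂ l) (L l) ℕ.< arcKey top (zone₂ r) (L r)
        key< rewrite zone₂-inside (Finₚ.<-trans a<r r<l) l<c | zone₂-inside a<r (Finₚ.<-trans r<l l<c) | Lr | Ll = prove< _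

      jirr-Inversion⁺ : ∀ {u v} → ArcInversion L a c u v → Inversion (jirr L a c) u v
      jirr-Inversion⁺ (inj₁ (refl , refl)) = byKey-Inversion (λ v → arcKey true (zone₂ v) (L v)) a<c key<
        where
        key< : arcKey true (zone₂ c) (L c) ℕ.< arcKey true (zone₂ a) (L a)
        key< rewrite zone₂-c | zone₂-a = prove< _
      jirr-Inversion⁺ (inj₂ inner) = arcPerm-Inversion⁺ true inner

      jirr-Inversion⁻ : ∀ {u v} → Inversion (jirr L a c) u v → ArcInversion L a c u v
      jirr-Inversion⁻ i with arcPerm-Inversion⁻ true i
      ... | inj₁ (_ , ends) = inj₁ ends
      ... | inj₂ inner = inj₂ inner

      jirr⁻-Inversion⁺ : ∀ {u v} → InnerInversion L a c u v → Inversion (jirr⁻ L a c) u v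
      jirr⁻-Inversion⁺ = arcPerm-Inversion⁺ false

      jirr⁻-Inversion⁻ : ∀ {u v} → Inversion (jirr⁻ L a c) u v → InnerInversion L a c u v
      jirr⁻-Inversion⁻ i with arcPerm-Inversion⁻ false i
      ... | inj₂ inner = inner

module _ {n : ℕ} {L : Fin n → Bool} where

  ArcInversion⇒< : ∀ {a c u v : Fin n} → a < c → ArcInversion L a c u v → u < v
  ArcInversion⇒< a<c (inj₁ (refl , refl)) = a<c
  ArcInversion⇒< _ (inj₂ (left a<l _ _)) = a<l
  ArcInversion⇒< _ (inj₂ (right _ r<c _)) = r<c
  ArcInversion⇒< _ (inj₂ (cross _ r<l _ _ _)) = r<l

  arc-left : ∀ {a b c u v : Fin n} → a < b → b < c → L b ≡ true → ArcInversion L a b u v → ArcInversion L a c u v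
  arc-left a<b b<c Lb (inj₁ (refl , refl)) = inj₂ (left a<b b<c Lb)
  arc-left a<b b<c Lb (inj₂ (left a<l l<b Ll)) = inj₂ (left a<l (Finₚ.<-trans l<b b<c) Ll)
  arc-left a<b b<c Lb (inj₂ (right a<r r<b Lr)) = inj₂ (cross a<r r<b b<c Lr Lb)
  arc-left a<b b<c Lb (inj₂ (cross a<r r<l l<b Lr Ll)) = inj₂ (cross a<r r<l (Finₚ.<-trans l<b b<c) Lr Ll)

  arc-right : ∀ {a b c u v : Fin n} → a < b → b < c → L b ≡ false → ArcInversion L b c u v → ArcInversion L a c u v
  arc-right a<b b<c Lb (inj₁ (refl , refl)) = inj₂ (right a<b b<c Lb)
  arc-right a<b b<c Lb (inj₂ (left b<l l<c Ll)) = inj₂ (cross a<b b<l l<c Lb Ll)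
  arc-right a<b b<c Lb (inj₂ (right b<r r<c Lr)) = inj₂ (right (Finₚ.<-trans a<b b<r) r<c Lr)
  arc-right a<b b<c Lb (inj₂ (cross b<r r<l l<c Lr Ll)) = inj₂ (cross (Finₚ.<-trans a<b b<r) r<l l<c Lr Ll)

  arc-hereditary : ∀ {a c u v s t : Fin n} → a < c → ArcInversion L a c u v → ArcInversion L u v s t → ArcInversion L a c s t
  arc-hereditary _ (inj₁ (refl , refl)) = id
  arc-hereditary _ (inj₂ (left a<l l<c Ll)) = arc-left a<l l<c Ll
  arc-hereditary _ (inj₂ (right a<r r<c Lr)) = arc-right a<r r<c Lr
  arc-hereditary _ (inj₂ (cross a<r r<l l<c Lr Ll)) = arc-left (Finₚ.<-trans a<r r<l) l<c Ll ∘ arc-right a<r r<l Lr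

  inner-point : ∀ {a c u v : Fin n} → InnerInversion L a c u v → ∃ λ w → a < w × w < c
  inner-point (left a<l l<c _) = _ , a<l , l<c
  inner-point (right a<r r<c _) = _ , a<r , r<c
  inner-point (cross a<r r<l l<c _ _) = _ , a<r , Finₚ.<-trans r<l l<c

  adjacent-arc : ∀ {a c u v : Fin n} → toℕ c ≡ suc (toℕ a) → ArcInversion L a c u v → u ≡ a × v ≡ c
  adjacent-arc c≡1+a (inj₁ ends) = ends
  adjacent-arc c≡1+a (inj₂ inner) with inner-point inner
  ... | _ , a<w , w<c = ⊥-elim (ℕₚ.<⇒≱ w<c (subst (ℕ._≤ _) (sym c≡1+a) a<w))

even : ℕ → Bool
even 0 = true
even 1 = false
even (suc (suc k)) = even k

∀-Bool? : ∀ {P : Bool → Set} → (∀ b → Dec (P b)) → Dec (∀ b → P b)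
∀-Bool? P? with P? true | P? false
... | yes p | yes q = yes λ { true → p ; false → q }
... | no ¬p | _ = no (λ all → ¬p (all true))
... | _ | no ¬q = no (λ all → ¬q (all false))

module _ {n : ℕ} where

  zone-bound : ∀ bs (v : Fin n) → zone bs v ℕ.≤ 2 * length bs
  zone-bound [] v = ℕ.z≤n
  zone-bound (b ∷ bs) v =
    ℕₚ.≤-trans (ℕₚ.+-mono-≤ (zoneOf≤2 b) (zone-bound bs v)) (ℕₚ.≤-reflexive (sym (ℕₚ.*-distribˡ-+ 2 1 (length bs))))
    where
    zoneOf≤2 : ∀ b → zoneOf b v ℕ.≤ 2
    zoneOf≤2 b with Finₚ.<-cmp b v
    ... | tri< _ _ _ = ℕₚ.≤-refl
    ... | tri≈ _ _ _ = ℕₚ.n≤1+n 1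
    ... | tri> _ _ _ = ℕ.z≤n

  zone-reflects : ∀ bs {u v : Fin n} → zone bs u ℕ.< zone bs v → u < v
  zone-reflects bs {u} {v} zu<zv with u <? v
  ... | yes u<v = u<v
  ... | no u≮v = ⊥-elim (ℕₚ.<⇒≱ zu<zv (zone-mono bs (ℕₚ.≮⇒≥ u≮v)))

  zone-step : ∀ bs {u v : Fin n} → u < v → zone bs u ℕ.< zone bs v ⊎ (zone bs u ≡ zone bs v × T (even (zone bs u)))
  zone-step [] u<v = inj₂ (refl , tt)
  zone-step (b ∷ bs) {u} {v} u<v with Finₚ.<-cmp b u | Finₚ.<-cmp b v
  ... | tri< _ _ _ | tri< _ _ _ = Sum.map (ℕₚ.+-monoʳ-< 2) (Product.map₁ (cong (2 +_))) (zone-step bs u<v)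
  ... | tri< b<u _ _ | tri≈ _ refl _ = ⊥-elim (Finₚ.<-asym b<u u<v)
  ... | tri< b<u _ _ | tri> _ _ v<b = ⊥-elim (Finₚ.<-asym (Finₚ.<-trans b<u u<v) v<b)
  ... | tri≈ _ refl _ | tri< _ _ _ = inj₁ (ℕₚ.+-monoʳ-≤ 2 (zone-mono bs (ℕₚ.<⇒≤ u<v)))
  ... | tri≈ _ refl _ | tri≈ _ refl _ = ⊥-elim (Finₚ.<-irrefl refl u<v)
  ... | tri≈ _ refl _ | tri> _ _ v<b = ⊥-elim (Finₚ.<-asym u<v v<b)
  ... | tri> _ _ _ | tri< _ _ _ = inj₁ (ℕₚ.≤-trans (ℕ.s≤s (zone-mono bs (ℕₚ.<⇒≤ u<v))) (ℕₚ.n≤1+n _))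
  ... | tri> _ _ _ | tri≈ _ _ _ = inj₁ (ℕ.s≤s (zone-mono bs (ℕₚ.<⇒≤ u<v)))
  ... | tri> _ _ _ | tri> _ _ _ = zone-step bs u<v

-- Permutations given by a key table on the classes (zone, side) of the elements; their
-- order relations are decided by evaluating the table on all pairs of classes.
module Tables {n : ℕ} (bs : List (Fin n)) (L : Fin n → Bool) {Occupied : ℕ → Set}
              (occupied? : ∀ z → Dec (Occupied z)) (occupied : ∀ v → Occupied (zone bs v)) where

  Table : Set
  Table = ℕ → Bool → ℕ

  perm : Table → Perm n
  perm t = byKey (λ v → t (zone bs v) (L v))

  Admissible : ℕ → ℕ → Set
  Admissible zu zv = Occupied zu × Occupied zv × (zu ℕ.< zv ⊎ (zu ≡ zv × T (even zu)))

  private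
    N : ℕ
    N = suc (2 * length bs)

    admissible? : ∀ zu zv → Dec (Admissible zu zv)
    admissible? zu zv = occupied? zu ×-dec occupied? zv ×-dec (zu ℕ.<? zv ⊎-dec (zu ℕ.≟ zv ×-dec T? _))

    admissible : ∀ {u v} → u < v → Admissible (zone bs u) (zone bs v)
    admissible {u} {v} u<v = occupied u , occupied v , zone-step bs u<v

  ForPairs : (ℕ → Bool → ℕ → Bool → Set) → Set
  ForPairs P = ∀ {zu} → zu ℕ.< N → ∀ lu {zv} → zv ℕ.< N → ∀ lv → Admissible zu zv → P zu lu zv lv

  forPairs? : ∀ {P} → (∀ zu lu zv lv → Dec (P zu lu zv lv)) → Dec (ForPairs P)
  forPairs? P? = ℕₚ.allUpTo? (λ zu → ∀-Bool? (λ lu →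
                  ℕₚ.allUpTo? (λ zv → ∀-Bool? (λ lv → admissible? zu zv →-dec P? zu lu zv lv)) N)) N

  private
    at : ∀ {P} → ForPairs P → ∀ {u v} → u < v → P (zone bs u) (L u) (zone bs v) (L v)
    at all {u} {v} u<v = all (ℕ.s≤s (zone-bound bs u)) (L u) (ℕ.s≤s (zone-bound bs v)) (L v) (admissible u<v)

  Flipped : Table → ℕ → Bool → ℕ → Bool → Set
  Flipped t zu lu zv lv = t zv lv ℕ.< t zu lu

  flipped? : ∀ t zu lu zv lv → Dec (Flipped t zu lu zv lv)
  flipped? t zu lu zv lv = t zv lv ℕ.<? t zu lu

  _⊑ᵗ_ : Table → Table → Set
  t₁ ⊑ᵗ t₂ = ForPairs λ zu lu zv lv → Flipped t₁ zu lu zv lv → Flipped t₂ zu lu zv lv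

  _⊑ᵗ?_ : ∀ t₁ t₂ → Dec (t₁ ⊑ᵗ t₂)
  t₁ ⊑ᵗ? t₂ = forPairs? λ zu lu zv lv → flipped? t₁ zu lu zv lv →-dec flipped? t₂ zu lu zv lv

  MeetBound : Table → Table → Table → Set
  MeetBound tA tB tM = ForPairs λ zu lu zv lv → Flipped tA zu lu zv lv → Flipped tB zu lu zv lv → Flipped tM zu lu zv lv

  meetBound? : ∀ tA tB tM → Dec (MeetBound tA tB tM)
  meetBound? tA tB tM = forPairs? λ zu lu zv lv → flipped? tA zu lu zv lv →-dec flipped? tB zu lu zv lv →-dec flipped? tM zu lu zv lv

  Through : Table → Table → ℕ → Bool → ℕ → Bool → ℕ → Bool → Set
  Through tA tB zp lp zu lu zv lv = zu ℕ.< zp × zp ℕ.< zv × Flipped tA zu lu zp lp × Flipped tB zp lp zv lv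

  JoinBound : Table → Table → ℕ → Table → Set
  JoinBound tA tB zp tT = ForPairs λ zu lu zv lv → ∀ lp → Flipped tT zu lu zv lv →
    Flipped tA zu lu zv lv ⊎ Flipped tB zu lu zv lv ⊎ Through tA tB zp lp zu lu zv lv ⊎ Through tB tA zp lp zu lu zv lv

  joinBound? : ∀ tA tB zp tT → Dec (JoinBound tA tB zp tT)
  joinBound? tA tB zp tT = forPairs? λ zu lu zv lv → ∀-Bool? λ lp → flipped? tT zu lu zv lv →-dec
    (flipped? tA zu lu zv lv ⊎-dec flipped? tB zu lu zv lv ⊎-dec through? tA tB zp lp zu lu zv lv ⊎-dec through? tB tA zp lp zu lu zv lv)
    where
    through? : ∀ tA tB zp lp zu lu zv lv → Dec (Through tA tB zp lp zu lu zv lv)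
    through? tA tB zp lp zu lu zv lv = zu ℕ.<? zp ×-dec zp ℕ.<? zv ×-dec flipped? tA zu lu zp lp ×-dec flipped? tB zp lp zv lv

  ⊑-by-table : ∀ {t₁ t₂} → t₁ ⊑ᵗ t₂ → perm t₁ ⊑ perm t₂
  ⊑-by-table t₁⊑t₂ i@(inversion u<v _) = byKey-Inversion _ u<v (at t₁⊑t₂ u<v (byKey-Inversion⁻ _ i))

  isMeet-by-table : ∀ {tA tB tM} → tM ⊑ᵗ tA → tM ⊑ᵗ tB → MeetBound tA tB tM → IsMeet (perm tA) (perm tB) (perm tM)
  isMeet-by-table {tA} {tB} {tM} M⊑A M⊑B bound = isMeet (⊑-by-table M⊑A) (⊑-by-table M⊑B) greatest
    where
    greatest : ∀ z → z ⊑ perm tA → z ⊑ perm tB → z ⊑ perm tM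
    greatest z z⊑A z⊑B i@(inversion u<v _) =
      byKey-Inversion _ u<v (at bound u<v (byKey-Inversion⁻ _ (z⊑A i)) (byKey-Inversion⁻ _ (z⊑B i)))

  isJoin-by-table : ∀ {tA tB tT p zp} → tA ⊑ᵗ tT → tB ⊑ᵗ tT → zone bs p ≡ zp → JoinBound tA tB zp tT →
                    IsJoin (perm tA) (perm tB) (perm tT)
  isJoin-by-table {tA} {tB} {tT} {p} A⊑T B⊑T refl bound = isJoin (⊑-by-table A⊑T) (⊑-by-table B⊑T) least
    where
    least : ∀ z → perm tA ⊑ z → perm tB ⊑ z → perm tT ⊑ z
    least z A⊑z B⊑z i@(inversion u<v _) with at bound u<v (L p) (byKey-Inversion⁻ _ i)
    ... | inj₁ A = A⊑z (byKey-Inversion _ u<v A)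
    ... | inj₂ (inj₁ B) = B⊑z (byKey-Inversion _ u<v B)
    ... | inj₂ (inj₂ (inj₁ (up , pv , A , B))) =
      Inversion-trans z (A⊑z (byKey-Inversion _ (zone-reflects bs up) A)) (B⊑z (byKey-Inversion _ (zone-reflects bs pv) B))
    ... | inj₂ (inj₂ (inj₂ (up , pv , B , A))) =
      Inversion-trans z (B⊑z (byKey-Inversion _ (zone-reflects bs up) B)) (A⊑z (byKey-Inversion _ (zone-reflects bs pv) A))

dropFirst dropMiddle dropLast : ℕ → ℕ
dropFirst z = z ∸ 2
dropMiddle z = z ℕ.⊓ 2 + (z ∸ 4)
dropLast z = z ℕ.⊓ 4

module ThreePoints {n : ℕ} {p q r : Fin n} (p<q : p < q) (q<r : q < r) where

  data Zone₃ (v : Fin n) : ℕ → ℕ → ℕ → Set where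
    below : v < p → Zone₃ v 0 0 0
    at-p  : v ≡ p → Zone₃ v 1 0 0
    p-q   : p < v → v < q → Zone₃ v 2 0 0
    at-q  : v ≡ q → Zone₃ v 2 1 0
    q-r   : q < v → v < r → Zone₃ v 2 2 0
    at-r  : v ≡ r → Zone₃ v 2 2 1
    above : r < v → Zone₃ v 2 2 2

  zone₃ : ∀ v → Zone₃ v (zoneOf p v) (zoneOf q v) (zoneOf r v)
  zone₃ v with Finₚ.<-cmp p v
  ... | tri> _ _ v<p rewrite zoneOf-> (Finₚ.<-trans v<p p<q) | zoneOf-> (Finₚ.<-trans v<p (Finₚ.<-trans p<q q<r)) = below v<p
  ... | tri≈ _ refl _ rewrite zoneOf-> p<q | zoneOf-> (Finₚ.<-trans p<q q<r) = at-p refl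
  ... | tri< p<v _ _ with Finₚ.<-cmp q v
  ...   | tri> _ _ v<q rewrite zoneOf-> (Finₚ.<-trans v<q q<r) = p-q p<v v<q
  ...   | tri≈ _ refl _ rewrite zoneOf-> q<r = at-q refl
  ...   | tri< q<v _ _ with Finₚ.<-cmp r v
  ...     | tri> _ _ v<r = q-r q<v v<r
  ...     | tri≈ _ refl _ = at-r refl
  ...     | tri< r<v _ _ = above r<v

  Zones : Fin n → Set
  Zones v = zone (q ∷ r ∷ []) v ≡ dropFirst (zone (p ∷ q ∷ r ∷ []) v) ×
            zone (p ∷ r ∷ []) v ≡ dropMiddle (zone (p ∷ q ∷ r ∷ []) v) ×
            zone (p ∷ q ∷ []) v ≡ dropLast (zone (p ∷ q ∷ r ∷ []) v)

  zone-p : zone (p ∷ q ∷ r ∷ []) p ≡ 1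
  zone-p rewrite zoneOf-self p | zoneOf-> p<q | zoneOf-> (Finₚ.<-trans p<q q<r) = refl

  zone-q : zone (p ∷ q ∷ r ∷ []) q ≡ 3
  zone-q rewrite zoneOf-< p<q | zoneOf-self q | zoneOf-> q<r = refl

  zone-r : zone (p ∷ q ∷ r ∷ []) r ≡ 5
  zone-r rewrite zoneOf-< (Finₚ.<-trans p<q q<r) | zoneOf-< q<r | zoneOf-self r = refl

  zones : ∀ v → Zones v
  zones v with zoneOf p v | zoneOf q v | zoneOf r v | zone₃ v
  ... | _ | _ | _ | below _ = refl , refl , refl
  ... | _ | _ | _ | at-p _ = refl , refl , refl
  ... | _ | _ | _ | p-q _ _ = refl , refl , refl
  ... | _ | _ | _ | at-q _ = refl , refl , refl
  ... | _ | _ | _ | q-r _ _ = refl , refl , refl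
  ... | _ | _ | _ | at-r _ = refl , refl , refl
  ... | _ | _ | _ | above _ = refl , refl , refl

-- Three points with zones 1, 3, 5 and the gap `gap` empty; J′ is the arc on two of them (zones
-- read off by proj), J the arc on the outer two. With W, T₀ = J′⁻ ∨ W, T₁ = J′ ∨ W and M = T₀ ∧ J
-- given by tables, the forcing square carries the contraction of J′ to J.
module ShrinkStep {n : ℕ} (bs : List (Fin n)) (L : Fin n → Bool) (gap : ℕ) (empty : ∀ v → zone bs v ≢ gap)
                  (proj : ℕ → ℕ) (W T₀ T₁ M : ℕ → Bool → ℕ) where

  open Tables bs L (λ z → ¬? (z ℕ.≟ gap)) empty

  J′ J′⁻ J J⁻ : Table
  J′ z = arcKey true (proj z)
  J′⁻ z = arcKey false (proj z)
  J z = arcKey true (dropMiddle z)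
  J⁻ z = arcKey false (dropMiddle z)

  Checks : Set
  Checks = (J′⁻ ⊑ᵗ T₀ × W ⊑ᵗ T₀ × JoinBound J′⁻ W 3 T₀) ×
           (J′ ⊑ᵗ T₁ × W ⊑ᵗ T₁ × JoinBound J′ W 3 T₁) ×
           (M ⊑ᵗ T₀ × M ⊑ᵗ J × MeetBound T₀ J M) ×
           J ⊑ᵗ T₁ × M ⊑ᵗ J⁻ × J⁻ ⊑ᵗ J

  checks? : Dec Checks
  checks? = ((J′⁻ ⊑ᵗ? T₀) ×-dec (W ⊑ᵗ? T₀) ×-dec joinBound? J′⁻ W 3 T₀) ×-dec
            ((J′ ⊑ᵗ? T₁) ×-dec (W ⊑ᵗ? T₁) ×-dec joinBound? J′ W 3 T₁) ×-dec
            ((M ⊑ᵗ? T₀) ×-dec (M ⊑ᵗ? J) ×-dec meetBound? T₀ J M) ×-dec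
            (J ⊑ᵗ? T₁) ×-dec (M ⊑ᵗ? J⁻) ×-dec (J⁻ ⊑ᵗ? J)

  module _ {R : Rel n} (R-cong : IsLatticeCongruence R) (a′ c′ a c p : Fin n)
           (zone′ : ∀ v → zone (a′ ∷ c′ ∷ []) v ≡ proj (zone bs v))
           (zone-ac : ∀ v → zone (a ∷ c ∷ []) v ≡ dropMiddle (zone bs v))
           (zone-p : zone bs p ≡ 3) where

    open LatticeCongruence R-cong

    private
      tabulated : ∀ top x y (f : ℕ → ℕ) → (∀ v → zone (x ∷ y ∷ []) v ≡ f (zone bs v)) →
                  R (arcPerm top L x y) (perm (λ z → arcKey top (f z)))
      tabulated top x y f e = ⊑-antisym⇒R (byKey-cong same) (byKey-cong (sym ∘ same))
        where
        same : ∀ v → arcKey top (zone (x ∷ y ∷ []) v) (L v) ≡ arcKey top (f (zone bs v)) (L v)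
        same v = cong (λ z → arcKey top z (L v)) (e v)

      shrink′ : Checks → R (jirr⁻ L a′ c′) (jirr L a′ c′) → R (jirr⁻ L a c) (jirr L a c)
      shrink′ ((J′⁻⊑T₀ , W⊑T₀ , bound₀) , (J′⊑T₁ , W⊑T₁ , bound₁) , (M⊑T₀ , M⊑J , boundM) , J⊑T₁ , M⊑J⁻ , J⁻⊑J) r =
        R-trans _ _ _ (tabulated false a c dropMiddle zone-ac) (R-trans _ _ _ square (R-sym _ _ (tabulated true a c dropMiddle zone-ac)))
        where
        r′ : R (perm J′⁻) (perm J′)
        r′ = R-trans _ _ _ (R-sym _ _ (tabulated false a′ c′ proj zone′)) (R-trans _ _ _ r (tabulated true a′ c′ proj zone′))
        square : R (perm J⁻) (perm J)
        square = forcing-square {W = perm W} {T₀ = perm T₀} r′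
          (isJoin-by-table J′⁻⊑T₀ W⊑T₀ zone-p bound₀) (isJoin-by-table J′⊑T₁ W⊑T₁ zone-p bound₁)
          (isMeet-by-table M⊑T₀ M⊑J boundM) (⊑-by-table J⊑T₁) (⊑-by-table M⊑J⁻) (⊑-by-table J⁻⊑J)

    -- a? is given: inferring it would make Agda evaluate checks? on open terms.
    shrink : True checks? → R (jirr⁻ L a′ c′) (jirr L a′ c′) → R (jirr⁻ L a c) (jirr L a c)
    shrink ok = shrink′ (toWitness {a? = checks?} ok)

-- Points a < d < c = d + 1; W exchanges d and c.
rightW rightT₀ rightT₁ rightM : ℕ → Bool → ℕ
rightW 0 _ = 0
rightW 1 _ = 0
rightW 2 _ = 0
rightW 5 _ = 1
rightW 3 _ = 2
rightW _ _ = 3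

rightT₁ 0 _ = 0
rightT₁ 2 l = if l then 0 else 4
rightT₁ 5 _ = 1
rightT₁ 3 _ = 2
rightT₁ 1 _ = 3
rightT₁ _ _ = 4

rightT₀ 0 _ = 0
rightT₀ 2 l = if l then 0 else 4
rightT₀ 1 _ = 1
rightT₀ 5 _ = 2
rightT₀ 3 _ = 3
rightT₀ _ _ = 4

rightM 0 _ = 0
rightM 2 l = if l then 0 else 4
rightM 1 _ = 1
rightM 3 l = if l then 2 else 4
rightM 5 _ = 3
rightM _ _ = 4

-- Points a < e = a + 1 < c; W exchanges a and e.
leftW leftT₀ leftT₁ leftM : ℕ → Bool → ℕ
leftW 0 _ = 0
leftW 3 _ = 1
leftW 1 _ = 2
leftW _ _ = 3

leftT₁ 0 _ = 0
leftT₁ 4 l = if l then 0 else 4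
leftT₁ 5 _ = 1
leftT₁ 3 _ = 2
leftT₁ 1 _ = 3
leftT₁ _ _ = 4

leftT₀ 0 _ = 0
leftT₀ 4 l = if l then 0 else 4
leftT₀ 3 _ = 1
leftT₀ 1 _ = 2
leftT₀ 5 _ = 3
leftT₀ _ _ = 4

leftM 0 _ = 0
leftM 4 l = if l then 0 else 4
leftM 3 l = if l then 0 else 2
leftM 1 _ = 1
leftM 5 _ = 3
leftM _ _ = 4

module _ {n : ℕ} {R : Rel n} (R-cong : IsLatticeCongruence R) (L : Fin n → Bool) where

  shrink-right : ∀ {a d c : Fin n} → a < d → toℕ c ≡ suc (toℕ d) →
                 R (jirr⁻ L a d) (jirr L a d) → R (jirr⁻ L a c) (jirr L a c)
  shrink-right {a} {d} {c} a<d c≡1+d =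
    ShrinkStep.shrink (a ∷ d ∷ c ∷ []) L 4 empty dropLast rightW rightT₀ rightT₁ rightM R-cong a d a c d
      (proj₂ ∘ proj₂ ∘ zones) (proj₁ ∘ proj₂ ∘ zones) zone-q tt
    where
    d<c : d < c
    d<c = subst (toℕ d ℕ.<_) (sym c≡1+d) (ℕₚ.n<1+n _)
    open ThreePoints a<d d<c
    empty : ∀ v → zone (a ∷ d ∷ c ∷ []) v ≢ 4
    empty v e = ℕₚ.<⇒≱ d<v (ℕₚ.≤-pred (subst (suc (toℕ v) ℕ.≤_) c≡1+d v<c))
      where
      d<v : d < v
      d<v = zone-reflects (a ∷ d ∷ c ∷ []) (subst₂ ℕ._<_ (sym zone-q) (sym e) (prove< _))
      v<c : v < c
      v<c = zone-reflects (a ∷ d ∷ c ∷ []) (subst₂ ℕ._<_ (sym e) (sym zone-r) (prove< _))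

  shrink-left : ∀ {a e c : Fin n} → toℕ e ≡ suc (toℕ a) → e < c →
                R (jirr⁻ L e c) (jirr L e c) → R (jirr⁻ L a c) (jirr L a c)
  shrink-left {a} {e} {c} e≡1+a e<c =
    ShrinkStep.shrink (a ∷ e ∷ c ∷ []) L 2 empty dropFirst leftW leftT₀ leftT₁ leftM R-cong e c a c e
      (proj₁ ∘ zones) (proj₁ ∘ proj₂ ∘ zones) zone-q tt
    where
    a<e : a < e
    a<e = subst (toℕ a ℕ.<_) (sym e≡1+a) (ℕₚ.n<1+n _)
    open ThreePoints a<e e<c
    empty : ∀ v → zone (a ∷ e ∷ c ∷ []) v ≢ 2
    empty v z≡2 = ℕₚ.<⇒≱ a<v (ℕₚ.≤-pred (subst (suc (toℕ v) ℕ.≤_) e≡1+a v<e))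
      where
      a<v : a < v
      a<v = zone-reflects (a ∷ e ∷ c ∷ []) (subst₂ ℕ._<_ (sym zone-p) (sym z≡2) (prove< _))
      v<e : v < e
      v<e = zone-reflects (a ∷ e ∷ c ∷ []) (subst₂ ℕ._<_ (sym z≡2) (sym zone-q) (prove< _))

true≢false : true ≢ false
true≢false ()

module _ {n : ℕ} where

  -- The side of the inner points of the Cambrian arcs; 0 and n - 1 are never inner points.
  sideAt : Orientation n → ℕ → Bool
  sideAt o zero = false
  sideAt o (suc i) with suc (suc i) ℕ.<? n
  ... | yes p = o i p
  ... | no _ = false

  side : Orientation n → Fin n → Bool
  side o b = sideAt o (toℕ b)

  side-spec : ∀ o i (p : suc (suc i) ℕ.< n) {b : Fin n} → toℕ b ≡ suc i → side o b ≡ o i p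
  side-spec o i p e rewrite e with suc (suc i) ℕ.<? n
  ... | yes p′ = cong (o i) (ℕₚ.<-irrelevant p′ p)
  ... | no ¬p = ⊥-elim (¬p p)

  Disagrees : Orientation n → (Fin n → Bool) → Fin n → Fin n → Set
  Disagrees o L a c = ∃ λ b → a < b × b < c × L b ≢ side o b

module Generators {n : ℕ} (i : ℕ) (p : suc (suc i) ℕ.< n) where

  -- Built exactly as in Generates, since sref depends on its proof argument.
  q : suc i ℕ.< n
  q = ℕₚ.<-trans (ℕₚ.n<1+n _) p

  A B C : Fin n
  A = fromℕ< (ℕₚ.<-trans (ℕₚ.n<1+n i) q)
  B = fromℕ< q
  C = fromℕ< p

  s₀ s₁ : Perm n
  s₀ = sref i q
  s₁ = sref (suc i) p

  toℕ-A : toℕ A ≡ i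
  toℕ-A = Finₚ.toℕ-fromℕ< _
  toℕ-B : toℕ B ≡ suc i
  toℕ-B = Finₚ.toℕ-fromℕ< _
  toℕ-C : toℕ C ≡ suc (suc i)
  toℕ-C = Finₚ.toℕ-fromℕ< _

  A<B : A < B
  A<B = subst₂ ℕ._<_ (sym toℕ-A) (sym toℕ-B) (ℕₚ.n<1+n i)
  B<C : B < C
  B<C = subst₂ ℕ._<_ (sym toℕ-B) (sym toℕ-C) (ℕₚ.n<1+n _)
  A<C : A < C
  A<C = Finₚ.<-trans A<B B<C

  private
    no-Inversion-id : ∀ {a b} → ¬ Inversion (Permutation.id {n}) a b
    no-Inversion-id (inversion a<b b<a) = Finₚ.<-asym a<b b<a

    module S₀ = AdjacentSwap (Permutation.id {n}) {A} {B} i q toℕ-A toℕ-B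
    module S₁ = AdjacentSwap (Permutation.id {n}) {B} {C} (suc i) p toℕ-B toℕ-C
    module S₁S₀ = AdjacentSwap s₁ {A} {C} i q (trans (cong toℕ (transpose-other C B (Finₚ.<⇒≢ A<C) (Finₚ.<⇒≢ A<B))) toℕ-A)
                                              (trans (cong toℕ (transpose-i C B)) toℕ-B)
    module S₀S₁ = AdjacentSwap s₀ {A} {C} (suc i) p (trans (cong toℕ (transpose-j B A)) toℕ-B)
                                                    (trans (cong toℕ (transpose-other B A (Finₚ.<⇒≢ B<C ∘ sym) (Finₚ.<⇒≢ A<C ∘ sym))) toℕ-C)

  s₀-Inversion⁻ : ∀ {a b} → Inversion s₀ a b → a ≡ A × b ≡ B
  s₀-Inversion⁻ i with S₀.Ascent.ascent-Inversion⁻ A<B i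
  ... | inj₁ i′ = ⊥-elim (no-Inversion-id i′)
  ... | inj₂ ends = ends

  s₁-Inversion⁻ : ∀ {a b} → Inversion s₁ a b → a ≡ B × b ≡ C
  s₁-Inversion⁻ i with S₁.Ascent.ascent-Inversion⁻ B<C i
  ... | inj₁ i′ = ⊥-elim (no-Inversion-id i′)
  ... | inj₂ ends = ends

  s₀-Inversion⁺ : Inversion s₀ A B
  s₀-Inversion⁺ = S₀.Ascent.ascent-Inversion A<B

  s₁-Inversion⁺ : Inversion s₁ B C
  s₁-Inversion⁺ = S₁.Ascent.ascent-Inversion B<C

  s₁s₀-Inversion⁻ : ∀ {a b} → Inversion (s₁ · s₀) a b → (a ≡ B × b ≡ C) ⊎ (a ≡ A × b ≡ C)
  s₁s₀-Inversion⁻ = Sum.map₁ s₁-Inversion⁻ ∘ S₁S₀.Ascent.ascent-Inversion⁻ A<C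

  s₁s₀-Inversion⁺ : ∀ {a b} → (a ≡ B × b ≡ C) ⊎ (a ≡ A × b ≡ C) → Inversion (s₁ · s₀) a b
  s₁s₀-Inversion⁺ (inj₁ (refl , refl)) = S₁S₀.Ascent.ascent-⊑ A<C s₁-Inversion⁺
  s₁s₀-Inversion⁺ (inj₂ (refl , refl)) = S₁S₀.Ascent.ascent-Inversion A<C

  s₀s₁-Inversion⁻ : ∀ {a b} → Inversion (s₀ · s₁) a b → (a ≡ A × b ≡ B) ⊎ (a ≡ A × b ≡ C)
  s₀s₁-Inversion⁻ = Sum.map₁ s₀-Inversion⁻ ∘ S₀S₁.Ascent.ascent-Inversion⁻ A<C

  s₀s₁-Inversion⁺ : ∀ {a b} → (a ≡ A × b ≡ B) ⊎ (a ≡ A × b ≡ C) → Inversion (s₀ · s₁) a b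
  s₀s₁-Inversion⁺ (inj₁ (refl , refl)) = S₀S₁.Ascent.ascent-⊑ A<C s₀-Inversion⁺
  s₀s₁-Inversion⁺ (inj₂ (refl , refl)) = S₀S₁.Ascent.ascent-Inversion A<C

module _ {n : ℕ} where

  predecessor : ∀ {b c : Fin n} → b < c → toℕ c ≢ suc (toℕ b) → ∃ λ d → b < d × toℕ c ≡ suc (toℕ d)
  predecessor {b} {c} b<c c≢1+b =
    d , b<d , trans (sym (ℕₚ.suc-pred (toℕ c) {{ℕ.>-nonZero (ℕₚ.≤-<-trans ℕ.z≤n b<c)}})) (cong suc (sym toℕ-d))
    where
    d : Fin n
    d = fromℕ< (ℕₚ.≤-<-trans ℕₚ.pred[n]≤n (Finₚ.toℕ<n c))
    toℕ-d : toℕ d ≡ ℕ.pred (toℕ c)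
    toℕ-d = Finₚ.toℕ-fromℕ< _
    b<d : b < d
    b<d = subst (toℕ b ℕ.<_) (sym toℕ-d) (ℕₚ.<⇒≤pred (ℕₚ.≤∧≢⇒< b<c (c≢1+b ∘ sym)))

  successor : ∀ {a b : Fin n} → a < b → toℕ b ≢ suc (toℕ a) → ∃ λ e → toℕ e ≡ suc (toℕ a) × e < b
  successor {a} {b} a<b b≢1+a = e , toℕ-e , subst (ℕ._< toℕ b) (sym toℕ-e) (ℕₚ.≤∧≢⇒< a<b (b≢1+a ∘ sym))
    where
    e : Fin n
    e = fromℕ< (ℕₚ.≤-<-trans a<b (Finₚ.toℕ<n b))
    toℕ-e : toℕ e ≡ suc (toℕ a)
    toℕ-e = Finₚ.toℕ-fromℕ< _

module Forcing {n : ℕ} (o : Orientation n) {R : Rel n} (R-cong : IsLatticeCongruence R) (R-gen : Generates o R) where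

  open LatticeCongruence R-cong

  module _ (i : ℕ) (p : suc (suc i) ℕ.< n) (L : Fin n → Bool) where

    open Generators i p

    private
      only-inner-point : ∀ {v} → A < v → v < C → v ≡ B
      only-inner-point {v} A<v v<C = Finₚ.toℕ-injective (ℕₚ.≤-antisym
        (ℕₚ.≤-pred (subst (toℕ v ℕ.<_) (trans toℕ-C (cong suc (sym toℕ-B))) v<C))
        (subst (ℕ._≤ toℕ v) (trans (cong suc toℕ-A) (sym toℕ-B)) A<v))

      inner : ∀ {u v} → InnerInversion L A C u v → (L B ≡ true × u ≡ A × v ≡ B) ⊎ (L B ≡ false × u ≡ B × v ≡ C)
      inner (left A<l l<C Ll) with only-inner-point A<l l<C
      ... | refl = inj₁ (Ll , refl , refl)
      inner (right A<r r<C Lr) with only-inner-point A<r r<C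
      ... | refl = inj₂ (Lr , refl , refl)
      inner (cross A<r r<l l<C _ _) =
        ⊥-elim (Finₚ.<⇒≢ r<l (trans (only-inner-point A<r (Finₚ.<-trans r<l l<C)) (sym (only-inner-point (Finₚ.<-trans A<r r<l) l<C))))

      contract-right : L B ≡ false → R s₁ (s₁ · s₀) → R (jirr⁻ L A C) (jirr L A C)
      contract-right LB s₁≡s₁s₀ =
        R-trans _ _ _ (⊑-antisym⇒R J⁻⊑s₁ s₁⊑J⁻) (R-trans _ _ _ s₁≡s₁s₀ (⊑-antisym⇒R s₁s₀⊑J J⊑s₁s₀))
        where
        B-right : InnerInversion L A C B C
        B-right = right A<B B<C LB
        J⁻⊑s₁ : jirr⁻ L A C ⊑ s₁
        J⁻⊑s₁ i with inner (jirr⁻-Inversion⁻ A<C L i)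
        ... | inj₁ (LB′ , _) = ⊥-elim (true≢false (trans (sym LB′) LB))
        ... | inj₂ (_ , refl , refl) = s₁-Inversion⁺
        s₁⊑J⁻ : s₁ ⊑ jirr⁻ L A C
        s₁⊑J⁻ i with s₁-Inversion⁻ i
        ... | refl , refl = jirr⁻-Inversion⁺ A<C L B-right
        s₁s₀⊑J : s₁ · s₀ ⊑ jirr L A C
        s₁s₀⊑J i with s₁s₀-Inversion⁻ i
        ... | inj₁ (refl , refl) = jirr-Inversion⁺ A<C L (inj₂ B-right)
        ... | inj₂ ends = jirr-Inversion⁺ A<C L (inj₁ ends)
        J⊑s₁s₀ : jirr L A C ⊑ s₁ · s₀
        J⊑s₁s₀ i with jirr-Inversion⁻ A<C L i
        ... | inj₁ ends = s₁s₀-Inversion⁺ (inj₂ ends)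
        ... | inj₂ i′ with inner i′
        ...   | inj₁ (LB′ , _) = ⊥-elim (true≢false (trans (sym LB′) LB))
        ...   | inj₂ (_ , ends) = s₁s₀-Inversion⁺ (inj₁ ends)

      contract-left : L B ≡ true → R s₀ (s₀ · s₁) → R (jirr⁻ L A C) (jirr L A C)
      contract-left LB s₀≡s₀s₁ =
        R-trans _ _ _ (⊑-antisym⇒R J⁻⊑s₀ s₀⊑J⁻) (R-trans _ _ _ s₀≡s₀s₁ (⊑-antisym⇒R s₀s₁⊑J J⊑s₀s₁))
        where
        B-left : InnerInversion L A C A B
        B-left = left A<B B<C LB
        J⁻⊑s₀ : jirr⁻ L A C ⊑ s₀
        J⁻⊑s₀ i with inner (jirr⁻-Inversion⁻ A<C L i)
        ... | inj₁ (_ , refl , refl) = s₀-Inversion⁺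
        ... | inj₂ (LB′ , _) = ⊥-elim (true≢false (trans (sym LB) LB′))
        s₀⊑J⁻ : s₀ ⊑ jirr⁻ L A C
        s₀⊑J⁻ i with s₀-Inversion⁻ i
        ... | refl , refl = jirr⁻-Inversion⁺ A<C L B-left
        s₀s₁⊑J : s₀ · s₁ ⊑ jirr L A C
        s₀s₁⊑J i with s₀s₁-Inversion⁻ i
        ... | inj₁ (refl , refl) = jirr-Inversion⁺ A<C L (inj₂ B-left)
        ... | inj₂ ends = jirr-Inversion⁺ A<C L (inj₁ ends)
        J⊑s₀s₁ : jirr L A C ⊑ s₀ · s₁
        J⊑s₀s₁ i with jirr-Inversion⁻ A<C L i
        ... | inj₁ ends = s₀s₁-Inversion⁺ (inj₂ ends)
        ... | inj₂ i′ with inner i′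
        ...   | inj₁ (_ , ends) = s₀s₁-Inversion⁺ (inj₁ ends)
        ...   | inj₂ (LB′ , _) = ⊥-elim (true≢false (trans (sym LB) LB′))

    -- The generator of the edge between s_i and s_(i+1) is exactly this contraction.
    contract-base : L B ≢ side o B → R (jirr⁻ L A C) (jirr L A C)
    contract-base L≢side with o i p | R-gen i p | side-spec o i p toℕ-B
    ... | true | s₁≡s₁s₀ | side≡ = contract-right (¬-not (L≢side ∘ flip trans (sym side≡))) s₁≡s₁s₀
    ... | false | s₀≡s₀s₁ | side≡ = contract-left (¬-not (L≢side ∘ flip trans (sym side≡))) s₀≡s₀s₁

  contract : ∀ L {a c} → Disagrees o L a c → R (jirr⁻ L a c) (jirr L a c)
  contract L {a} {c} = contract′ (toℕ c) (ℕₚ.m≤m+n (toℕ c) (toℕ a))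
    where
    contract′ : ∀ f {a c} → toℕ c ℕ.≤ f + toℕ a → Disagrees o L a c → R (jirr⁻ L a c) (jirr L a c)
    contract′ zero c≤a (_ , a<b , b<c , _) = ⊥-elim (ℕₚ.<⇒≱ (Finₚ.<-trans a<b b<c) c≤a)
    contract′ (suc f) {a} {c} c≤ (b , a<b , b<c , wrong) with toℕ c ℕ.≟ suc (toℕ b) | toℕ b ℕ.≟ suc (toℕ a)
    ... | no c≢1+b | _ with predecessor b<c c≢1+b
    ...   | d , b<d , c≡1+d = shrink-right R-cong L (Finₚ.<-trans a<b b<d) c≡1+d
                                (contract′ f (ℕₚ.≤-pred (subst (ℕ._≤ suc f + toℕ a) c≡1+d c≤)) (b , a<b , b<d , wrong))
    contract′ (suc f) {a} {c} c≤ (b , a<b , b<c , wrong) | yes _ | no b≢1+a with successor a<b b≢1+a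
    ...   | e , e≡1+a , e<b = shrink-left R-cong L e≡1+a (Finₚ.<-trans e<b b<c)
                                (contract′ f (subst (toℕ c ℕ.≤_) (trans (sym (ℕₚ.+-suc f (toℕ a))) (cong (f +_) (sym e≡1+a))) c≤) (b , e<b , b<c , wrong))
    contract′ (suc f) {a} {c} c≤ (b , a<b , b<c , wrong) | yes c≡1+b | yes b≡1+a =
      subst₂ (λ a c → R (jirr⁻ L a c) (jirr L a c)) (sym a≡A) (sym c≡C)
        (contract-base (toℕ a) p L (subst (λ w → L w ≢ side o w) b≡B wrong))
      where
      c≡2+a : toℕ c ≡ suc (suc (toℕ a))
      c≡2+a = trans c≡1+b (cong suc b≡1+a)
      p : suc (suc (toℕ a)) ℕ.< n
      p = subst (ℕ._< n) c≡2+a (Finₚ.toℕ<n c)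
      open Generators (toℕ a) p using (A; B; C; toℕ-A; toℕ-B; toℕ-C)
      a≡A : a ≡ A
      a≡A = Finₚ.toℕ-injective (sym toℕ-A)
      b≡B : b ≡ B
      b≡B = Finₚ.toℕ-injective (trans b≡1+a (sym toℕ-B))
      c≡C : c ≡ C
      c≡C = Finₚ.toℕ-injective (trans c≡2+a (sym toℕ-C))

  module _ (x : Perm n) {u v : Fin n} (k : ℕ) (k+1<n : suc k ℕ.< n)
           (pos-u : toℕ (pos x u) ≡ k) (pos-v : toℕ (pos x v) ≡ suc k) (v<u : v < u) where

    open AdjacentSwap x k k+1<n pos-u pos-v
    open Descent v<u

    before-u : Fin n → Bool
    before-u w = does (Before? x w u)

    private
      before : ∀ {w} → before-u w ≡ true → Before x w u
      before {w} e with Before? x w u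
      ... | yes wu = wu
      ... | no ¬wu = ⊥-elim (true≢false (trans (sym e) (dec-false (Before? x w u) ¬wu)))

      after : ∀ {w} → w ≢ u → before-u w ≡ false → Before x u w
      after {w} w≢u e with Before-total x w≢u
      ... | inj₁ wu = ⊥-elim (true≢false (trans (sym (dec-true (Before? x w u) wu)) e))
      ... | inj₂ uw = uw

      inner⊑x : ∀ {s t} → InnerInversion before-u v u s t → Inversion x s t
      inner⊑x (left v<l l<u Ll) = inversion v<l (Finₚ.<-trans (before Ll) u-before-v)
      inner⊑x (right v<r r<u Lr) = inversion r<u (after (Finₚ.<⇒≢ r<u) Lr)
      inner⊑x (cross v<r r<l l<u Lr Ll) = inversion r<l (Finₚ.<-trans (before Ll) (after (Finₚ.<⇒≢ (Finₚ.<-trans r<l l<u)) Lr))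

      inner≢ends : ∀ {s t} → InnerInversion before-u v u s t → ¬ (s ≡ v × t ≡ u)
      inner≢ends (left v<l l<u _) (_ , l≡u) = Finₚ.<⇒≢ l<u l≡u
      inner≢ends (right v<r _ _) (r≡v , _) = Finₚ.<⇒≢ v<r (sym r≡v)
      inner≢ends (cross v<r _ _ _ _) (r≡v , _) = Finₚ.<⇒≢ v<r (sym r≡v)

      jirr⁻⊑swapped : jirr⁻ before-u v u ⊑ swapped
      jirr⁻⊑swapped {s} {t} i = descent-keeps (inner⊑x inner) (inner≢ends inner)
        where
        inner : InnerInversion before-u v u s t
        inner = jirr⁻-Inversion⁻ v<u before-u i

      is-join : IsJoin (jirr before-u v u) swapped x
      is-join = isJoin jirr⊑x descent-⊑ least
        where
        jirr⊑x : jirr before-u v u ⊑ x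
        jirr⊑x i with jirr-Inversion⁻ v<u before-u i
        ... | inj₁ (refl , refl) = descent-Inversion
        ... | inj₂ inner = inner⊑x inner
        least : ∀ z → jirr before-u v u ⊑ z → swapped ⊑ z → x ⊑ z
        least z J⊑z sw⊑z {s} {t} i with s Fin.≟ v | t Fin.≟ u
        ... | yes refl | yes refl = J⊑z (jirr-Inversion⁺ v<u before-u (inj₁ (refl , refl)))
        ... | no s≢v | _ = sw⊑z (descent-keeps i (s≢v ∘ proj₁))
        ... | yes _ | no t≢u = sw⊑z (descent-keeps i (t≢u ∘ proj₂))

    -- Undoing an adjacent descent u v of x is forced once some b between v and u is on the wrong side of u.
    descent-contracted : Disagrees o before-u v u → R swapped x
    descent-contracted disagree = join-resp {w = swapped} (contract before-u disagree) (join-of-⊑ jirr⁻⊑swapped) is-join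

module Cambrian {n : ℕ} (o : Orientation n) where

  -- Reading's pattern characterisation of the bottoms of the Cambrian classes (a < b < c):
  -- no b … c … a with b on the right side, no c … a … b with b on the left side.
  Avoids : Perm n → Set
  Avoids x = ∀ {a b c} → a < b → b < c →
             (side o b ≡ false → ¬ (Before x b c × Before x c a)) × (side o b ≡ true → ¬ (Before x c a × Before x a b))

  ArcBelow : Perm n → Fin n → Fin n → Set
  ArcBelow x a c = ∀ {u v} → ArcInversion (side o) a c u v → Inversion x u v

  CambrianStep : Perm n → Fin n → Fin n → Set
  CambrianStep x a c = a < c × ArcBelow x a c

  ArcGenerated : Perm n → Set
  ArcGenerated x = ∀ {a c} → Inversion x a c → TransClosure (CambrianStep x) a c

  private
    unforced : ∀ {x b i j} → IsCambrianMin o x → (s : Straddle x b i j) →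
               does (Before? x b (Straddle.u s)) ≢ side o b → ⊥
    unforced {x} {b} x-min s wrong = descent-removes (≤w⇒⊑ (x-min swapped forced (⊑⇒≤w descent-⊑)) descent-Inversion)
      where
      open Straddle s
      open AdjacentSwap x k k+1<n pos-u pos-v
      open Descent (Finₚ.<-trans v<b b<u)
      forced : Θ o swapped x
      forced R R-cong R-gen =
        Forcing.descent-contracted o R-cong R-gen x k k+1<n pos-u pos-v (Finₚ.<-trans v<b b<u) (b , v<b , b<u , wrong)

  min⇒avoids : ∀ {x} → IsCambrianMin o x → Avoids x
  min⇒avoids {x} x-min {a} {b} {c} a<b b<c = lower , upper
    where
    lower : side o b ≡ false → ¬ (Before x b c × Before x c a)
    lower sb (bc , ca) = unforced x-min s (λ e → true≢false (trans (sym (dec-true (Before? x b u) b-before-u)) (trans e sb)))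
      where
      s : Straddle x b (toℕ (pos x c)) (toℕ (pos x a))
      s = straddle x a<b b<c ca (inj₁ bc)
      open Straddle s
      b-before-u : Before x b u
      b-before-u = subst (toℕ (pos x b) ℕ.<_) (sym pos-u) (ℕₚ.<-≤-trans bc i≤k)
    upper : side o b ≡ true → ¬ (Before x c a × Before x a b)
    upper sb (ca , ab) = unforced x-min s (λ e → true≢false (trans (sym sb) (trans (sym e) (dec-false (Before? x b u) ¬b-before-u))))
      where
      s : Straddle x b (toℕ (pos x c)) (toℕ (pos x a))
      s = straddle x a<b b<c ca (inj₂ ab)
      open Straddle s
      ¬b-before-u : ¬ Before x b u
      ¬b-before-u bu = ℕₚ.<-asym (ℕₚ.<-trans (subst (ℕ._< toℕ (pos x a)) (sym pos-u) k<j) ab) bu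

  avoids⇒arcGenerated : ∀ {x} → Avoids x → ArcGenerated x
  avoids⇒arcGenerated {x} avoids {a} {c} = generate (toℕ c) (ℕₚ.m≤m+n (toℕ c) (toℕ a))
    where
    generate : ∀ f {a c} → toℕ c ℕ.≤ f + toℕ a → Inversion x a c → TransClosure (CambrianStep x) a c
    generate zero c≤a (inversion a<c _) = ⊥-elim (ℕₚ.<⇒≱ a<c c≤a)
    generate (suc f) {a} {c} c≤ ac@(inversion a<c ca)
      with Finₚ.any? (λ t → a <? t ×-dec t <? c ×-dec Inversion? x a t ×-dec Inversion? x t c)
    ... | yes (t , a<t , t<c , at , tc) = generate f (fuel-left {f} t<c c≤) at ++ generate f (fuel-right {f} a<t c≤) tc
    ... | no unsplit = [ a<c , below ]
      where
      to-left : ∀ {l} → a < l → l < c → side o l ≡ true → Inversion x a l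
      to-left {l} a<l l<c sl with Inversion? x a l
      ... | yes al = al
      ... | no ¬al = ⊥-elim (proj₂ (avoids a<l l<c) sl (ca , ¬Inversion⇒Before x a<l ¬al))
      to-right : ∀ {r} → a < r → r < c → side o r ≡ false → Inversion x r c
      to-right {r} a<r r<c sr with Inversion? x r c
      ... | yes rc = rc
      ... | no ¬rc = ⊥-elim (proj₁ (avoids a<r r<c) sr (¬Inversion⇒Before x r<c ¬rc , ca))
      below : ArcBelow x a c
      below (inj₁ (refl , refl)) = ac
      below (inj₂ (left a<l l<c sl)) = to-left a<l l<c sl
      below (inj₂ (right a<r r<c sr)) = to-right a<r r<c sr
      below (inj₂ (cross {r} {l} a<r r<l l<c sr sl)) = inversion r<l (Finₚ.<-trans (Finₚ.<-trans l-before-c ca) a-before-r)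
        where
        l-before-c : Before x l c
        l-before-c = ¬Inversion⇒Before x l<c (λ lc → unsplit (l , Finₚ.<-trans a<r r<l , l<c , to-left (Finₚ.<-trans a<r r<l) l<c sl , lc))
        a-before-r : Before x a r
        a-before-r = ¬Inversion⇒Before x a<r (λ ar → unsplit (r , a<r , Finₚ.<-trans r<l l<c , ar , to-right a<r (Finₚ.<-trans r<l l<c) sr))

  module _ {x y m : Perm n} (M : IsMeet x y m) (avoids-x : Avoids x) (avoids-y : Avoids y) where

    private
      open MeetOf {x = x} {y} {m} M

      chain : ∀ {a c} → NonInversion m a c → TransClosure (EitherNonInversion x y) a c
      chain = meet-chain {x = x} {y} {m} M

      unchain : ∀ {a c} → TransClosure (EitherNonInversion x y) a c → NonInversion m a c
      unchain = meet-chain⁻ {x = x} {y} {m} M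

      module _ {a b c : Fin n} (a<b : a < b) (b<c : b < c) (ca : Before m c a) where

        c-before-a : ∀ {w} → m ⊑ w → Before w c a
        c-before-a m⊑w = Inversion.flipped (m⊑w (inversion (Finₚ.<-trans a<b b<c) ca))

        lower-in : ∀ {w} → Avoids w → m ⊑ w → side o b ≡ false → ∀ {t} → NonInversion w b t →
                   t ≡ c ⊎ (t < c × side o t ≡ true) → ⊥
        lower-in avoids-w m⊑w sb (noninversion _ bc) (inj₁ refl) = proj₁ (avoids-w a<b b<c) sb (bc , c-before-a m⊑w)
        lower-in {w} avoids-w m⊑w sb (noninversion b<t bt) (inj₂ (t<c , st)) = proj₂ (avoids-w b<t t<c) st (cb , bt)
          where
          cb : Before w c b
          cb with Before-total w (Finₚ.<⇒≢ b<c ∘ sym)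
          ... | inj₁ cb = cb
          ... | inj₂ bc = ⊥-elim (proj₁ (avoids-w a<b b<c) sb (bc , c-before-a m⊑w))

        upper-in : ∀ {w} → Avoids w → m ⊑ w → side o b ≡ true → ∀ {t} → NonInversion w t b →
                   t ≡ a ⊎ (a < t × side o t ≡ false) → ⊥
        upper-in avoids-w m⊑w sb (noninversion _ ab) (inj₁ refl) = proj₂ (avoids-w a<b b<c) sb (c-before-a m⊑w , ab)
        upper-in {w} avoids-w m⊑w sb (noninversion t<b tb) (inj₂ (a<t , st)) = proj₁ (avoids-w a<t t<b) st (tb , ba)
          where
          ba : Before w b a
          ba with Before-total w (Finₚ.<⇒≢ a<b ∘ sym)
          ... | inj₁ ba = ba
          ... | inj₂ ab = ⊥-elim (proj₂ (avoids-w a<b b<c) sb (c-before-a m⊑w , ab))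

        lower-either : side o b ≡ false → ∀ {t} → EitherNonInversion x y b t → t ≡ c ⊎ (t < c × side o t ≡ true) → ⊥
        lower-either sb = Sum.[ lower-in avoids-x lowerˡ sb , lower-in avoids-y lowerʳ sb ]

        upper-either : side o b ≡ true → ∀ {t} → EitherNonInversion x y t b → t ≡ a ⊎ (a < t × side o t ≡ false) → ⊥
        upper-either sb = Sum.[ upper-in avoids-x lowerˡ sb , upper-in avoids-y lowerʳ sb ]

      -- Walk along the chain of non-inversions of x or y that makes up b … c (resp. a … b) in m.
      lower : ∀ f {a b c} → toℕ c ℕ.≤ f + toℕ b → a < b → b < c → side o b ≡ false → Before m b c → Before m c a → ⊥
      lower zero c≤b _ b<c _ _ _ = ℕₚ.<⇒≱ b<c c≤b
      lower (suc f) {a} {b} {c} c≤ a<b b<c sb bc ca with chain (noninversion b<c bc)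
      ... | [ step ] = lower-either a<b b<c ca sb step (inj₁ refl)
      ... | _∷_ {y = t} step rest with side o t in st
      ...   | true = lower-either a<b b<c ca sb step (inj₂ (NonInversion.ordered (unchain rest) , st))
      ...   | false = lower f (fuel-right {f} b<t c≤) (Finₚ.<-trans a<b b<t) (NonInversion.ordered tc) st (NonInversion.kept tc) ca
        where
        b<t : b < t
        b<t = NonInversion.ordered (unchain [ step ])
        tc : NonInversion m t c
        tc = unchain rest

      upper : ∀ f {a b c} → toℕ b ℕ.≤ f + toℕ a → a < b → b < c → side o b ≡ true → Before m c a → Before m a b → ⊥
      upper zero b≤a a<b _ _ _ _ = ℕₚ.<⇒≱ a<b b≤a
      upper (suc f) {a} {b} {c} b≤ a<b b<c sb ca ab with chain-unsnoc (chain (noninversion a<b ab))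
      ... | inj₁ step = upper-either a<b b<c ca sb step (inj₁ refl)
      ... | inj₂ (t , rest , step) with side o t in st
      ...   | false = upper-either a<b b<c ca sb step (inj₂ (NonInversion.ordered (unchain rest) , st))
      ...   | true = upper f (fuel-left {f} t<b b≤) (NonInversion.ordered at) (Finₚ.<-trans t<b b<c) st ca (NonInversion.kept at)
        where
        at : NonInversion m a t
        at = unchain rest
        t<b : t < b
        t<b = NonInversion.ordered (unchain [ step ])

    avoids-meet : Avoids m
    avoids-meet {a} {b} {c} a<b b<c =
      (λ sb (bc , ca) → lower (toℕ c) (ℕₚ.m≤m+n (toℕ c) (toℕ b)) a<b b<c sb bc ca) ,
      (λ sb (ca , ab) → upper (toℕ b) (ℕₚ.m≤m+n (toℕ b) (toℕ a)) a<b b<c sb ca ab)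

  ArcBelow-mono : ∀ {x y a c} → x ⊑ y → ArcBelow x a c → ArcBelow y a c
  ArcBelow-mono x⊑y below = x⊑y ∘ below

  arcGenerated-⊑ : ∀ {x z} → ArcGenerated x → (∀ {a c} → a < c → ArcBelow x a c → ArcBelow z a c) → x ⊑ z
  arcGenerated-⊑ {z = z} generated x→z =
    transitive⁻ (Inversion z) (Inversion-trans z) ∘ chain-map (λ { (a<c , below) → x→z a<c below (inj₁ (refl , refl)) }) ∘ generated

  SameArcs : Perm n → Perm n → Set
  SameArcs x y = ∀ {a c} → a < c → ArcBelow x a c ⇔ ArcBelow y a c

  module _ {x y j : Perm n} (J : IsJoin x y j) where

    EitherStep : Fin n → Fin n → Set
    EitherStep a c = CambrianStep x a c ⊎ CambrianStep y a c

    private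
      open JoinOf {x = x} {y} {j} J

      cotrans-left : ∀ {w : Perm n} {a b c : Fin n} → a < b → b < c → Inversion w a c → ¬ Inversion w b c → Inversion w a b
      cotrans-left {w} a<b b<c ac ¬bc = Sum.[ id , ⊥-elim ∘ ¬bc ] (Inversion-cotrans w a<b b<c ac)

      cotrans-right : ∀ {w : Perm n} {a b c : Fin n} → a < b → b < c → Inversion w a c → ¬ Inversion w a b → Inversion w b c
      cotrans-right {w} a<b b<c ac ¬ab = Sum.[ ⊥-elim ∘ ¬ab , id ] (Inversion-cotrans w a<b b<c ac)

      Upper Lower : Fin n → Fin n → Fin n → Set
      Upper a c b = side o b ≡ true × Inversion j b c
      Lower a c b = side o b ≡ false × Inversion j a b

      -- With no inner point forcing a split, the arc below j is already below x or below y.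
      unsplit : ∀ {w : Perm n} {a c : Fin n} → w ⊑ j → Inversion w a c → (∀ {b} → a < b → b < c → ¬ Upper a c b) →
                (∀ {b} → a < b → b < c → ¬ Lower a c b) → ArcBelow w a c
      unsplit w⊑j ac no-upper no-lower (inj₁ (refl , refl)) = ac
      unsplit w⊑j ac no-upper no-lower (inj₂ (left a<l l<c sl)) = cotrans-left a<l l<c ac (λ lc → no-upper a<l l<c (sl , w⊑j lc))
      unsplit w⊑j ac no-upper no-lower (inj₂ (right a<r r<c sr)) = cotrans-right a<r r<c ac (λ ar → no-lower a<r r<c (sr , w⊑j ar))
      unsplit w⊑j ac no-upper no-lower (inj₂ (cross a<r r<l l<c sr sl)) =
        cotrans-left r<l l<c (cotrans-right a<r (Finₚ.<-trans r<l l<c) ac (λ ar → no-lower a<r (Finₚ.<-trans r<l l<c) (sr , w⊑j ar)))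
          (λ lc → no-upper (Finₚ.<-trans a<r r<l) l<c (sl , w⊑j lc))

    join-arcs : ∀ {a c} → a < c → ArcBelow j a c → TransClosure EitherStep a c
    join-arcs {a} {c} = decompose (toℕ c) (ℕₚ.m≤m+n (toℕ c) (toℕ a))
      where
      decompose : ∀ f {a c} → toℕ c ℕ.≤ f + toℕ a → a < c → ArcBelow j a c → TransClosure EitherStep a c
      decompose zero c≤a a<c _ = ⊥-elim (ℕₚ.<⇒≱ a<c c≤a)
      decompose (suc f) {a} {c} c≤ a<c below with greatest-in (λ b → side o b Bool.≟ true ×-dec Inversion? j b c) a c
      ... | inj₂ (b , a<b , b<c , (sb , bc) , highest) =
        decompose f (fuel-left {f} b<c c≤) a<b (below ∘ arc-left a<b b<c sb) ++ decompose f (fuel-right {f} a<b c≤) b<c below-bc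
        where
        below-bc : ArcBelow j b c
        below-bc (inj₁ (refl , refl)) = bc
        below-bc (inj₂ (left b<l l<c sl)) = cotrans-left b<l l<c bc (λ lc → highest b<l l<c (sl , lc))
        below-bc (inj₂ (right b<r r<c sr)) = below (inj₂ (right (Finₚ.<-trans a<b b<r) r<c sr))
        below-bc (inj₂ (cross b<r r<l l<c sr sl)) = below (inj₂ (cross (Finₚ.<-trans a<b b<r) r<l l<c sr sl))
      ... | inj₁ no-upper with least-in (λ b → side o b Bool.≟ false ×-dec Inversion? j a b) a c
      ...   | inj₂ (b , a<b , b<c , (sb , ab) , lowest) =
        decompose f (fuel-left {f} b<c c≤) a<b below-ab ++ decompose f (fuel-right {f} a<b c≤) b<c (below ∘ arc-right a<b b<c sb)
        where
        below-ab : ArcBelow j a b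
        below-ab (inj₁ (refl , refl)) = ab
        below-ab (inj₂ (left a<l l<b sl)) = below (inj₂ (left a<l (Finₚ.<-trans l<b b<c) sl))
        below-ab (inj₂ (right a<r r<b sr)) = cotrans-right a<r r<b ab (λ ar → lowest a<r r<b (sr , ar))
        below-ab (inj₂ (cross a<r r<l l<b sr sl)) = below (inj₂ (cross a<r r<l (Finₚ.<-trans l<b b<c) sr sl))
      ...   | inj₁ no-lower with join-chain {x = x} {y} {j} J (below (inj₁ (refl , refl)))
      ...     | [ inj₁ xac ] = [ inj₁ (a<c , unsplit upperˡ xac (λ a<b b<c → no-upper a<b b<c) (λ a<b b<c → no-lower a<b b<c)) ]
      ...     | [ inj₂ yac ] = [ inj₂ (a<c , unsplit upperʳ yac (λ a<b b<c → no-upper a<b b<c) (λ a<b b<c → no-lower a<b b<c)) ]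
      ...     | step ∷ rest = ⊥-elim (through (join-chain⁻ {x = x} {y} {j} J [ step ]) (join-chain⁻ {x = x} {y} {j} J rest))
        where
        through : ∀ {t} → Inversion j a t → Inversion j t c → ⊥
        through {t} at@(inversion a<t _) tc@(inversion t<c _) with side o t in st
        ... | true = no-upper a<t t<c (st , tc)
        ... | false = no-lower a<t t<c (st , at)

  private
    ArcBelow⇒⊑ : ∀ {w a c} → a < c → ArcBelow w a c → jirr (side o) a c ⊑ w
    ArcBelow⇒⊑ a<c below = below ∘ jirr-Inversion⁻ a<c (side o)

    ⊑⇒ArcBelow : ∀ {w a c} → a < c → jirr (side o) a c ⊑ w → ArcBelow w a c
    ⊑⇒ArcBelow a<c J⊑w = J⊑w ∘ jirr-Inversion⁺ a<c (side o)

    SameArcs-sym : ∀ {x y} → SameArcs x y → SameArcs y x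
    SameArcs-sym x~y a<c = mk⇔ (Equivalence.from (x~y a<c)) (Equivalence.to (x~y a<c))

    meet-arcs : ∀ {x x′ y y′ m m′} → SameArcs x x′ → SameArcs y y′ → IsMeet x y m → IsMeet x′ y′ m′ →
                ∀ {a c} → a < c → ArcBelow m a c → ArcBelow m′ a c
    meet-arcs {x} {x′} {y} {y′} {m} {m′} x~x′ y~y′ M M′ {a} {c} a<c below =
      ⊑⇒ArcBelow a<c (M′.greatest (J⊑ x~x′ M.lowerˡ) (J⊑ y~y′ M.lowerʳ))
      where
      module M = MeetOf {x = x} {y} {m} M
      module M′ = MeetOf {x = x′} {y′} {m′} M′
      J⊑ : ∀ {w w′} → SameArcs w w′ → m ⊑ w → jirr (side o) a c ⊑ w′
      J⊑ w~w′ m⊑w = ArcBelow⇒⊑ a<c (Equivalence.to (w~w′ a<c) (ArcBelow-mono m⊑w below))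

    join-arcs-resp : ∀ {x x′ y y′ j j′} → SameArcs x x′ → SameArcs y y′ → IsJoin x y j → IsJoin x′ y′ j′ →
                     ∀ {a c} → a < c → ArcBelow j a c → ArcBelow j′ a c
    join-arcs-resp {x} {x′} {y} {y′} {j} {j′} x~x′ y~y′ J J′ a<c below ai =
      transitive⁻ (Inversion j′) (Inversion-trans j′)
        (chain-map step (join-arcs {x = x} {y} {j} J (ArcInversion⇒< a<c ai) (below ∘ arc-hereditary a<c ai)))
      where
      module J′ = JoinOf {x = x′} {y′} {j′} J′
      step : ∀ {s t} → EitherStep {x = x} {y} {j} J s t → Inversion j′ s t
      step (inj₁ (s<t , below-x)) = J′.upperˡ (Equivalence.to (x~x′ s<t) below-x (inj₁ (refl , refl)))
      step (inj₂ (s<t , below-y)) = J′.upperʳ (Equivalence.to (y~y′ s<t) below-y (inj₁ (refl , refl)))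

  sameArcs-congruence : IsLatticeCongruence SameArcs
  sameArcs-congruence = record
    { refl = λ _ _ → mk⇔ id id
    ; sym = λ _ _ → SameArcs-sym
    ; trans = λ _ _ _ x~y y~z a<c → mk⇔ (Equivalence.to (y~z a<c) ∘ Equivalence.to (x~y a<c))
                                         (Equivalence.from (x~y a<c) ∘ Equivalence.from (y~z a<c))
    ; meet-compat = λ _ _ _ _ _ _ x~x′ y~y′ M M′ a<c →
        mk⇔ (meet-arcs x~x′ y~y′ M M′ a<c) (meet-arcs (SameArcs-sym x~x′) (SameArcs-sym y~y′) M′ M a<c)
    ; join-compat = λ _ _ _ _ _ _ x~x′ y~y′ J J′ a<c →
        mk⇔ (join-arcs-resp x~x′ y~y′ J J′ a<c) (join-arcs-resp (SameArcs-sym x~x′) (SameArcs-sym y~y′) J′ J a<c)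
    }

  sameArcs-generated : Generates o SameArcs
  sameArcs-generated i p with o i p in e
  ... | true = λ a<c → mk⇔ (ArcBelow-mono s₁⊑s₁s₀) (back a<c)
    where
    open Generators i p
    sB : side o B ≡ true
    sB = trans (side-spec o i p toℕ-B) e
    s₁⊑s₁s₀ : s₁ ⊑ s₁ · s₀
    s₁⊑s₁s₀ inv with s₁-Inversion⁻ inv
    ... | ends = s₁s₀-Inversion⁺ (inj₁ ends)
    back : ∀ {a c} → a < c → ArcBelow (s₁ · s₀) a c → ArcBelow s₁ a c
    back a<c below ai with s₁s₀-Inversion⁻ (below (inj₁ (refl , refl)))
    ... | inj₁ (refl , refl) with adjacent-arc (trans toℕ-C (cong suc (sym toℕ-B))) ai
    ...   | refl , refl = s₁-Inversion⁺
    back a<c below ai | inj₂ (refl , refl) with s₁s₀-Inversion⁻ (below (inj₂ (left A<B B<C sB)))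
    ...   | inj₁ (A≡B , _) = ⊥-elim (Finₚ.<⇒≢ A<B A≡B)
    ...   | inj₂ (_ , B≡C) = ⊥-elim (Finₚ.<⇒≢ B<C B≡C)
  ... | false = λ a<c → mk⇔ (ArcBelow-mono s₀⊑s₀s₁) (back a<c)
    where
    open Generators i p
    sB : side o B ≡ false
    sB = trans (side-spec o i p toℕ-B) e
    s₀⊑s₀s₁ : s₀ ⊑ s₀ · s₁
    s₀⊑s₀s₁ inv with s₀-Inversion⁻ inv
    ... | ends = s₀s₁-Inversion⁺ (inj₁ ends)
    back : ∀ {a c} → a < c → ArcBelow (s₀ · s₁) a c → ArcBelow s₀ a c
    back a<c below ai with s₀s₁-Inversion⁻ (below (inj₁ (refl , refl)))
    ... | inj₁ (refl , refl) with adjacent-arc (trans toℕ-B (cong suc (sym toℕ-A))) ai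
    ...   | refl , refl = s₀-Inversion⁺
    back a<c below ai | inj₂ (refl , refl) with s₀s₁-Inversion⁻ (below (inj₂ (right A<B B<C sB)))
    ...   | inj₁ (B≡A , _) = ⊥-elim (Finₚ.<⇒≢ A<B (sym B≡A))
    ...   | inj₂ (B≡A , _) = ⊥-elim (Finₚ.<⇒≢ A<B (sym B≡A))

  Θ⇒SameArcs : ∀ {x y} → Θ o x y → SameArcs x y
  Θ⇒SameArcs θ = θ SameArcs sameArcs-congruence sameArcs-generated

theorem6p5 : (n : ℕ) (o : Orientation n) →
    (∀ x y m → IsCambrianMin o x → IsCambrianMin o y → IsMeet x y m → IsCambrianMin o m) ×
    (∀ x y j → IsCambrianMin o x → IsCambrianMin o y → IsJoin x y j → IsCambrianMin o j)
theorem6p5 n o = meet-closed , join-closed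
  where
  open Cambrian o

  meet-closed : ∀ x y m → IsCambrianMin o x → IsCambrianMin o y → IsMeet x y m → IsCambrianMin o m
  meet-closed x y m x-min y-min M z z≡m _ =
    ⊑⇒≤w (arcGenerated-⊑ m-generated (λ a<c → Equivalence.from (Θ⇒SameArcs z≡m a<c)))
    where
    m-generated : ArcGenerated m
    m-generated = avoids⇒arcGenerated (avoids-meet {x = x} {y} {m} M (min⇒avoids x-min) (min⇒avoids y-min))

  join-closed : ∀ x y j → IsCambrianMin o x → IsCambrianMin o y → IsJoin x y j → IsCambrianMin o j
  join-closed x y j x-min y-min J z z≡j _ = ⊑⇒≤w (least (below-z x-min upperˡ) (below-z y-min upperʳ))
    where
    open JoinOf {x = x} {y} {j} J
    below-z : ∀ {w} → IsCambrianMin o w → w ⊑ j → w ⊑ z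
    below-z w-min w⊑j = arcGenerated-⊑ (avoids⇒arcGenerated (min⇒avoids w-min))
                                         (λ a<c → Equivalence.from (Θ⇒SameArcs z≡j a<c) ∘ ArcBelow-mono w⊑j)
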